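{- Let $m\ge 1$. If $C$ is a critical set of a matrix $M\in\Lambda_{2m}^m$, then $|C|\le 3m^2-2m$.
   Context: $\Lambda_{n}^{x}$ is the set of $n\times n$ $(0,1)$-matrices with every row sum and every column sum equal to $x$. A matrix $M$ is identified with the set of triples $\{(i,j,M_{ij})\}$. A subset $D\subseteq M$ is a defining set for $M$ if $M$ is the unique element of $\Lambda_{2m}^m$ containing $D$; a critical set is a defining set none of whose proper subsets is a defining set; $|C|$ is its number of triples. -}

module Defs where

open import Data.Nat using (ℕ; _+_; _*_; _∸_; _≤_)
open import Data.Bool using (Bool; true; false; T; if_then_else_)
open import Data.Fin using (Fin)
open import Data.List using (List; map; allFin)
open import Data.Nat.ListAction using (sum)
open import Data.Product using (_×_; Σ)
open import Relation.Binary.PropositionalEquality using (_≡_)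
open import Relation.Nullary using (¬_)

-- An n×n (0,1)-matrix, entries as Booleans (true = 1, false = 0).
Matrix : ℕ → Set
Matrix n = Fin n → Fin n → Bool

countTrue : {n : ℕ} → (Fin n → Bool) → ℕ
countTrue {n} v = sum (map (λ i → if v i then 1 else 0) (allFin n))

rowSum : {n : ℕ} → Matrix n → Fin n → ℕ
rowSum M i = countTrue (λ j → M i j)

colSum : {n : ℕ} → Matrix n → Fin n → ℕ
colSum M j = countTrue (λ i → M i j)

InΛ : (n x : ℕ) → Matrix n → Set
InΛ n x M = ((i : Fin n) → rowSum M i ≡ x) × ((j : Fin n) → colSum M j ≡ x)

-- A subset D ⊆ M (M viewed as its set of triples (i,j,M i j)) is determined
-- by the set of positions (i,j) it contains; we represent it by that set.
PosSet : ℕ → Set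
PosSet n = Fin n → Fin n → Bool

card : {n : ℕ} → PosSet n → ℕ
card {n} D = sum (map (λ i → countTrue (D i)) (allFin n))

_⊆ₚ_ : {n : ℕ} → PosSet n → PosSet n → Set
D ⊆ₚ D' = ∀ i j → T (D i j) → T (D' i j)

_⊂ₚ_ : {n : ℕ} → PosSet n → PosSet n → Set
D ⊂ₚ D' = D ⊆ₚ D' × ¬ (D' ⊆ₚ D)

Contains : {n : ℕ} → Matrix n → PosSet n → Matrix n → Set
Contains M D N = ∀ i j → T (D i j) → N i j ≡ M i j

IsDefining : (m : ℕ) → Matrix (2 * m) → PosSet (2 * m) → Set
IsDefining m M D = ∀ N → InΛ (2 * m) m N → Contains M D N → ∀ i j → N i j ≡ M i j

IsCritical : (m : ℕ) → Matrix (2 * m) → PosSet (2 * m) → Set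
IsCritical m M C = IsDefining m M C × (∀ D → D ⊂ₚ C → ¬ IsDefining m M D)

module Submission where

open import Defs
open import Data.Nat.Properties
open import Algebra.Properties.CommutativeMonoid.Sum +-0-commutativeMonoid
  using (sum; sum-syntax; ∑-distrib-+; ∑-comm; sum-cong-≗; sum-replicate-zero)
open import Data.Bool using (Bool; true; false; not; _∧_; _∨_; _xor_; if_then_else_; T)
open import Data.Bool.Properties
  using (∧-comm; ∧-assoc; ∧-zeroʳ; ∧-identityʳ; ∨-zeroʳ; ¬-not; not-¬; not-involutive; T-≡; xor-identityʳ; xor-comm)
import Data.Bool.Properties as Bool
open import Data.Empty using (⊥; ⊥-elim)
open import Data.Fin using (Fin; zero; suc; toℕ; fromℕ<)
open import Data.Fin.Properties using (any?; toℕ-fromℕ<; toℕ<n; pigeonhole)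
open import Data.List using (allFin; map; tabulate)
open import Data.List.Properties using (map-tabulate)
import Data.Nat.ListAction as ListAction
open import Data.Nat using (ℕ; zero; suc; _+_; _*_; _∸_; _≤_; _<_; _⊓_; z≤n; s≤s; _<?_; _≤?_; >-nonZero)
open import Data.Nat.Tactic.RingSolver using (solve-∀)
open import Data.Product using (_,_; _×_; proj₁; proj₂; ∃)
open import Data.Sum using (_⊎_; inj₁; inj₂; [_,_]′)
import Data.Sum as Sum
open import Function using (_∘_; id)
open import Function.Bundles using (module Equivalence)
open import Relation.Binary.PropositionalEquality
  using (_≡_; refl; sym; trans; cong; cong₂; subst; subst₂; module ≡-Reasoning)
open import Relation.Nullary using (¬_; yes; no)

-- Read M ∈ Λ_{2m}^m as a bipartite digraph: each cell not in the critical
-- set C (a free cell) is an edge, row → column where M = 1 and column → row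
-- where M = 0.  Any other completion N of C differs from M on free cells, and
-- by `Balance` the cells where they differ enter and leave every set of rows
-- and columns equally often.  Two consequences of criticality follow:
--   * `critical-cells-stay-out`: a cell of C, read as an edge, never enters
--     a set closed under free edges (else C minus that cell would define M);
--   * `sink-exists`: every nonempty set of rows and columns has a sink, a
--     line with no free edge into the set (a free cycle could be switched).

ι : Bool → ℕ
ι b = if b then 1 else 0

_==_ : ∀ {n} → Fin n → Fin n → Bool
zero  == zero  = true
zero  == suc j = false
suc i == zero  = false
suc i == suc j = i == j

==-refl : ∀ {n} (i : Fin n) → (i == i) ≡ true
==-refl zero    = refl
==-refl (suc i) = ==-refl i

==-sound : ∀ {n} (i j : Fin n) → (i == j) ≡ true → i ≡ j
==-sound zero    zero    _ = refl
==-sound (suc i) (suc j) e = cong suc (==-sound i j e)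

==-sym : ∀ {n} (i j : Fin n) → (i == j) ≡ (j == i)
==-sym zero    zero    = refl
==-sym zero    (suc j) = refl
==-sym (suc i) zero    = refl
==-sym (suc i) (suc j) = ==-sym i j

∧-true : ∀ {a b} → a ∧ b ≡ true → a ≡ true × b ≡ true
∧-true {true} e = refl , e

∨-true : ∀ {a b} → a ∨ b ≡ true → a ≡ true ⊎ b ≡ true
∨-true {true}  _ = inj₁ refl
∨-true {false} e = inj₂ e

∧-middle : ∀ a b c → (a ∧ b) ∧ c ≡ (a ∧ c) ∧ b
∧-middle true  b c = ∧-comm b c
∧-middle false b c = refl

∧-rotate : ∀ a b c → (a ∧ b) ∧ c ≡ (c ∧ b) ∧ a
∧-rotate true  b c = trans (∧-comm b c) (sym (∧-identityʳ (c ∧ b)))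
∧-rotate false b c = sym (∧-zeroʳ (c ∧ b))

not-true : ∀ {b} → not b ≡ true → b ≡ false
not-true {false} _ = refl

not-false : ∀ {b} → not b ≡ false → b ≡ true
not-false {true} _ = refl

Fin⇒∸1< : ∀ {k} → Fin k → k ∸ 1 < k
Fin⇒∸1< {suc k} _ = ≤-refl

∑-mono : ∀ {n} {f g : Fin n → ℕ} → (∀ i → f i ≤ g i) → sum f ≤ sum g
∑-mono {zero}  h = z≤n
∑-mono {suc n} h = +-mono-≤ (h zero) (∑-mono (h ∘ suc))

∑-zero : ∀ {n} {f : Fin n → ℕ} → (∀ i → f i ≡ 0) → sum f ≡ 0
∑-zero {n} h = trans (sum-cong-≗ h) (sum-replicate-zero n)

∑-ones : ∀ n → ∑[ i < n ] 1 ≡ n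
∑-ones zero    = refl
∑-ones (suc n) = cong suc (∑-ones n)

∑-term : ∀ {n} (f : Fin n → ℕ) (p : Fin n) → f p ≤ sum f
∑-term f zero    = m≤m+n _ _
∑-term f (suc p) = ≤-trans (∑-term (f ∘ suc) p) (m≤n+m _ _)

∑-pos : ∀ {n} (f : Fin n → ℕ) → 0 < sum f → ∃ λ i → 0 < f i
∑-pos {suc n} f pos with f zero in e
... | suc _ = zero , subst (0 <_) (sym e) (s≤s z≤n)
... | zero  = let (i , fi) = ∑-pos (f ∘ suc) pos in suc i , fi

∑-single : ∀ {n} (f : Fin n → ℕ) (v : Fin n) → (∀ i → (i == v) ≡ false → f i ≡ 0) → sum f ≡ f v
∑-single f zero    h = trans (cong (f zero +_) (∑-zero (λ i → h (suc i) refl))) (+-identityʳ _)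
∑-single f (suc v) h = trans (cong (_+ sum (f ∘ suc)) (h zero refl)) (∑-single (f ∘ suc) v (h ∘ suc))

count : ∀ {n} → (Fin n → Bool) → ℕ
count v = sum (λ i → ι (v i))

listSum≡∑ : ∀ n (f : Fin n → ℕ) → ListAction.sum (map f (allFin n)) ≡ sum f
listSum≡∑ zero    f = refl
listSum≡∑ (suc n) f = cong (f zero +_) (begin
  ListAction.sum (map f (tabulate suc))         ≡⟨ cong ListAction.sum (map-tabulate suc f) ⟩
  ListAction.sum (tabulate (f ∘ suc))           ≡⟨ cong ListAction.sum (sym (map-tabulate id (f ∘ suc))) ⟩
  ListAction.sum (map (f ∘ suc) (allFin n))     ≡⟨ listSum≡∑ n (f ∘ suc) ⟩
  sum (f ∘ suc)                                 ∎)
  where open ≡-Reasoning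

countTrue≡count : ∀ {n} (v : Fin n → Bool) → countTrue v ≡ count v
countTrue≡count {n} v = listSum≡∑ n (ι ∘ v)

count-cong : ∀ {n} {v w : Fin n → Bool} → (∀ i → v i ≡ w i) → count v ≡ count w
count-cong h = sum-cong-≗ (cong ι ∘ h)

count-none : ∀ {n} (v : Fin n → Bool) → (∀ i → v i ≡ false) → count v ≡ 0
count-none v h = ∑-zero (cong ι ∘ h)

count-all : ∀ {n} (v : Fin n → Bool) → (∀ i → v i ≡ true) → count v ≡ n
count-all {n} v h = trans (sum-cong-≗ (cong ι ∘ h)) (∑-ones n)

count-at : ∀ {n} (v : Fin n → Bool) p → count (λ i → v i ∧ (i == p)) ≡ ι (v p)
count-at v p = trans (∑-single _ p (λ i e → cong ι (trans (cong (v i ∧_) e) (∧-zeroʳ (v i)))))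
                     (cong ι (trans (cong (v p ∧_) (==-refl p)) (∧-identityʳ (v p))))

count-point : ∀ {n} (p : Fin n) → count (_== p) ≡ 1
count-point p = count-at (λ _ → true) p

count-pos : ∀ {n} (v : Fin n → Bool) i → v i ≡ true → 1 ≤ count v
count-pos v i e = ≤-trans (≤-reflexive (sym (cong ι e))) (∑-term _ i)

count-split : ∀ {n} (v w : Fin n → Bool) →
  count v ≡ count (λ i → v i ∧ w i) + count (λ i → v i ∧ not (w i))
count-split v w = trans (sum-cong-≗ (λ i → split (v i) (w i))) (∑-distrib-+ (λ i → ι (v i ∧ w i)) (λ i → ι (v i ∧ not (w i))))
  where
  split : ∀ a b → ι a ≡ ι (a ∧ b) + ι (a ∧ not b)
  split true  true  = refl
  split true  false = refl
  split false b     = refl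

count-complement : ∀ {n} (v : Fin n → Bool) → count (λ i → not (v i)) + count v ≡ n
count-complement {n} v = begin
  count (λ i → not (v i)) + count v    ≡⟨ sym (∑-distrib-+ (λ i → ι (not (v i))) (λ i → ι (v i))) ⟩
  ∑[ i < n ] (ι (not (v i)) + ι (v i)) ≡⟨ sum-cong-≗ (λ i → ι-not (v i)) ⟩
  ∑[ i < n ] 1                         ≡⟨ ∑-ones n ⟩
  n                                    ∎
  where
  open ≡-Reasoning
  ι-not : ∀ a → ι (not a) + ι a ≡ 1
  ι-not true  = refl
  ι-not false = refl

_⊆ᵇ_ : ∀ {n} → (Fin n → Bool) → (Fin n → Bool) → Set
v ⊆ᵇ w = ∀ i → v i ≡ true → w i ≡ true

ι-mono : ∀ {a b} → (a ≡ true → b ≡ true) → ι a ≤ ι b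
ι-mono {false} h = z≤n
ι-mono {true}  h rewrite h refl = ≤-refl

ι-positive : ∀ {b} → 0 < ι b → b ≡ true
ι-positive {true} _ = refl

count-mono : ∀ {n} {v w : Fin n → Bool} → v ⊆ᵇ w → count v ≤ count w
count-mono h = ∑-mono (λ i → ι-mono (h i))

count-strict : ∀ {n} {v w : Fin n → Bool} (j : Fin n) →
  v ⊆ᵇ w → w j ≡ true → v j ≡ false → suc (count v) ≤ count w
count-strict {n} {v} {w} j v⊆w wj vj = subst (_≤ count w) total (∑-mono pointwise)
  where
  pointwise : ∀ i → ι (v i) + ι (i == j) ≤ ι (w i)
  pointwise i with i == j in e
  ... | true  rewrite ==-sound i j e | vj | wj = ≤-refl
  ... | false rewrite +-identityʳ (ι (v i)) = ι-mono (v⊆w i)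
  total : ∑[ i < n ] (ι (v i) + ι (i == j)) ≡ suc (count v)
  total = begin
    ∑[ i < n ] (ι (v i) + ι (i == j))   ≡⟨ ∑-distrib-+ (λ i → ι (v i)) (λ i → ι (i == j)) ⟩
    count v + count (_== j)              ≡⟨ cong (count v +_) (count-point j) ⟩
    count v + 1                          ≡⟨ +-comm (count v) 1 ⟩
    suc (count v)                        ∎
    where open ≡-Reasoning

count-eq-⊇ : ∀ {n} {v w : Fin n → Bool} → v ⊆ᵇ w → count v ≡ count w → w ⊆ᵇ v
count-eq-⊇ {v = v} v⊆w e i wi with v i in vi
... | true  = refl
... | false = ⊥-elim (<-irrefl e (count-strict i v⊆w wi vi))

count-diff : ∀ {n} (v w : Fin n → Bool) → count v ≡ count w →
  count (λ i → v i ∧ not (w i)) ≡ count (λ i → not (v i) ∧ w i)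
count-diff v w e = +-cancelˡ-≡ (count (λ i → v i ∧ w i)) _ _ (begin
  count (λ i → v i ∧ w i) + count (λ i → v i ∧ not (w i)) ≡⟨ sym (count-split v w) ⟩
  count v                                                 ≡⟨ e ⟩
  count w                                                 ≡⟨ count-split w v ⟩
  count (λ i → w i ∧ v i) + count (λ i → w i ∧ not (v i))
    ≡⟨ cong₂ _+_ (count-cong (λ i → ∧-comm (w i) (v i))) (count-cong (λ i → ∧-comm (w i) (not (v i)))) ⟩
  count (λ i → v i ∧ w i) + count (λ i → not (v i) ∧ w i) ∎)
  where open ≡-Reasoning

count-flip : ∀ {n} (v f : Fin n → Bool) (p q : Fin n) → v p ≡ true → v q ≡ false →
  (∀ i → f i ≡ ((i == p) ∨ (i == q))) → count (λ i → v i xor f i) ≡ count v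
count-flip {n} v f p q vp vq hf = +-cancelʳ-≡ 1 _ _ (begin
  count (λ i → v i xor f i) + 1                     ≡⟨ cong (count (λ i → v i xor f i) +_) (sym (count-point p)) ⟩
  count (λ i → v i xor f i) + count (_== p)         ≡⟨ sym (∑-distrib-+ (λ i → ι (v i xor f i)) (λ i → ι (i == p))) ⟩
  ∑[ i < n ] (ι (v i xor f i) + ι (i == p))         ≡⟨ sum-cong-≗ pointwise ⟩
  ∑[ i < n ] (ι (v i) + ι (i == q))                 ≡⟨ ∑-distrib-+ (λ i → ι (v i)) (λ i → ι (i == q)) ⟩
  count v + count (_== q)                           ≡⟨ cong (count v +_) (count-point q) ⟩
  count v + 1                                       ∎)
  where
  open ≡-Reasoning
  pointwise : ∀ i → ι (v i xor f i) + ι (i == p) ≡ ι (v i) + ι (i == q)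
  pointwise i with i == p in ep | i == q in eq
  ... | true  | true  = ⊥-elim (not-¬ vp (trans (cong v (trans (sym (==-sound i p ep)) (==-sound i q eq))) vq))
  ... | true  | false rewrite hf i | ep | ==-sound i p ep | vp = refl
  ... | false | true  rewrite hf i | ep | eq | ==-sound i q eq | vq = refl
  ... | false | false rewrite hf i | ep | eq with v i
  ...   | true  = refl
  ...   | false = refl

cells : ∀ {n} → (Fin n → Fin n → Bool) → ℕ
cells P = sum (λ i → count (P i))

cells-cong : ∀ {n} {P Q : Fin n → Fin n → Bool} → (∀ i j → P i j ≡ Q i j) → cells P ≡ cells Q
cells-cong h = sum-cong-≗ (λ i → count-cong (h i))

cells-split : ∀ {n} (P Q : Fin n → Fin n → Bool) →
  cells P ≡ cells (λ i j → P i j ∧ Q i j) + cells (λ i j → P i j ∧ not (Q i j))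
cells-split P Q = trans (sum-cong-≗ (λ i → count-split (P i) (Q i))) (∑-distrib-+ (λ i → count (λ j → P i j ∧ Q i j)) (λ i → count (λ j → P i j ∧ not (Q i j))))

cells-transpose : ∀ {n} (P : Fin n → Fin n → Bool) → cells P ≡ cells (λ j i → P i j)
cells-transpose P = ∑-comm (λ i j → ι (P i j))

cells-none : ∀ {n} (P : Fin n → Fin n → Bool) → (∀ i j → P i j ≡ false) → cells P ≡ 0
cells-none P h = ∑-zero (λ i → count-none (P i) (h i))

cells-row : ∀ {n} (P : Fin n → Fin n → Bool) v → cells (λ i j → P i j ∧ (i == v)) ≡ count (P v)
cells-row P v = trans (∑-single _ v off-row) (count-cong (λ j → trans (cong (P v j ∧_) (==-refl v)) (∧-identityʳ (P v j))))
  where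
  off-row : ∀ i → (i == v) ≡ false → count (λ j → P i j ∧ (i == v)) ≡ 0
  off-row i e = count-none _ (λ j → trans (cong (P i j ∧_) e) (∧-zeroʳ (P i j)))

cells-col : ∀ {n} (P : Fin n → Fin n → Bool) w → cells (λ i j → P i j ∧ (j == w)) ≡ count (λ i → P i w)
cells-col P w = sum-cong-≗ (λ i → trans (∑-single _ w (off-col i)) (cong ι (trans (cong (P i w ∧_) (==-refl w)) (∧-identityʳ (P i w)))))
  where
  off-col : ∀ i j → (j == w) ≡ false → ι (P i j ∧ (j == w)) ≡ 0
  off-col i j e = cong ι (trans (cong (P i j ∧_) e) (∧-zeroʳ (P i j)))

cells-pos : ∀ {n} (P : Fin n → Fin n → Bool) i j → P i j ≡ true → 1 ≤ cells P
cells-pos P i j e = ≤-trans (count-pos (P i) j e) (∑-term _ i)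

cells-witness : ∀ {n} (P : Fin n → Fin n → Bool) → 0 < cells P → ∃ λ i → ∃ λ j → P i j ≡ true
cells-witness P pos = let (i , row-pos) = ∑-pos _ pos ; (j , cell-pos) = ∑-pos _ row-pos in i , j , ι-positive cell-pos

cells-mono : ∀ {n} {P Q : Fin n → Fin n → Bool} → (∀ i → P i ⊆ᵇ Q i) → cells P ≤ cells Q
cells-mono P⊆Q = ∑-mono (λ i → count-mono (P⊆Q i))

card≡cells : ∀ {n} (D : PosSet n) → card D ≡ cells D
card≡cells {n} D = trans (listSum≡∑ n (λ i → countTrue (D i))) (sum-cong-≗ (λ i → countTrue≡count (D i)))

data Search {n} (f : Fin n → Bool) : Set where
  found : ∀ i → f i ≡ true → Search f
  none  : (∀ i → f i ≡ false) → Search f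

search : ∀ {n} (f : Fin n → Bool) → Search f
search f with any? (λ i → f i Bool.≟ true)
... | yes (i , fi) = found i fi
... | no  ¬∃      = none (λ i → ¬-not (λ fi → ¬∃ (i , fi)))

opaque
  exists : ∀ {n} → (Fin n → Bool) → Bool
  exists f with search f
  ... | found _ _ = true
  ... | none _    = false

  exists-sound : ∀ {n} (f : Fin n → Bool) → exists f ≡ true → ∃ λ i → f i ≡ true
  exists-sound f e with search f
  ... | found i fi = i , fi

  exists-complete : ∀ {n} (f : Fin n → Bool) i → f i ≡ true → exists f ≡ true
  exists-complete f i fi with search f
  ... | found _ _ = refl
  ... | none h    = ⊥-elim (not-¬ fi (h i))

  choose : ∀ {n} → Fin n → (Fin n → Bool) → Fin n
  choose d f with search f
  ... | found i _ = i
  ... | none _    = d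

  choose-spec : ∀ {n} d (f : Fin n → Bool) → (∃ λ i → f i ≡ true) → f (choose d f) ≡ true
  choose-spec d f (i , fi) with search f
  ... | found _ fj = fj
  ... | none h     = ⊥-elim (not-¬ fi (h i))

-- A suitable set of a rows and b columns, both fewer
-- than 2m, carries at most  bound m a b  cells of a critical set (see
-- `peeling`); with a' = min(a,m), b' = min(b,m) it is
--   a'b' - min(a',b') + (b-m)(a'-1) + (a-m)(b'-1).

bound : ℕ → ℕ → ℕ → ℕ
bound m a b = (a ⊓ m) * (b ⊓ m) ∸ ((a ⊓ m) ⊓ (b ⊓ m)) + (b ∸ m) * ((a ⊓ m) ∸ 1) + (a ∸ m) * ((b ⊓ m) ∸ 1)

bound-sym : ∀ m a b → bound m a b ≡ bound m b a
bound-sym m a b = begin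
  X + P + Q   ≡⟨ +-assoc X P Q ⟩
  X + (P + Q) ≡⟨ cong₂ _+_ (cong₂ _∸_ (*-comm a' b') (⊓-comm a' b')) (+-comm P Q) ⟩
  X' + (Q + P) ≡⟨ sym (+-assoc X' Q P) ⟩
  X' + Q + P  ∎
  where
  open ≡-Reasoning
  a' = a ⊓ m
  b' = b ⊓ m
  X = a' * b' ∸ (a' ⊓ b')
  X' = b' * a' ∸ (b' ⊓ a')
  P = (b ∸ m) * (a' ∸ 1)
  Q = (a ∸ m) * (b' ∸ 1)

∸-+-≤ : ∀ {p k q l} x → k ≤ p → l ≤ q → p + x + l ≤ q + k → p ∸ k + x ≤ q ∸ l
∸-+-≤ {p} {k} {q} {l} x k≤p l≤q h
  with p' , refl ← m≤n⇒∃[o]m+o≡n k≤p | q' , refl ← m≤n⇒∃[o]m+o≡n l≤q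
  rewrite m+n∸m≡n k p' | m+n∸m≡n l q' =
  +-cancelˡ-≤ (k + l) _ _ (subst₂ _≤_ (lhs k p' x l) (rhs l q' k) h)
  where
  lhs : ∀ k p' x l → k + p' + x + l ≡ k + l + (p' + x)
  lhs = solve-∀
  rhs : ∀ l q' k → l + q' + k ≡ k + l + q'
  rhs = solve-∀

quadratic-step : ∀ a B x → (x ≡ 0 ⊎ x < B) → a * B ∸ (a ⊓ B) + x ≤ (B + a * B) ∸ (suc a ⊓ B)
quadratic-step a B x hx with a <? B
... | yes a<B rewrite m≤n⇒m⊓n≡m (<⇒≤ a<B) | m≤n⇒m⊓n≡m a<B =
  ∸-+-≤ x a≤aB (≤-trans a<B (m≤m+n B (a * B)))
    (subst₂ _≤_ (sym (e a B x)) (sym (+-assoc B (a * B) a)) (+-monoˡ-≤ (a * B + a) x<B))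
  where
  a≤aB : a ≤ a * B
  a≤aB = m≤m*n a B {{>-nonZero (≤-trans (s≤s z≤n) a<B)}}
  x<B : x < B
  x<B = [ (λ x≡0 → subst (_< B) (sym x≡0) (≤-trans (s≤s z≤n) a<B)) , id ]′ hx
  e : ∀ a B x → a * B + x + suc a ≡ suc x + (a * B + a)
  e = solve-∀
... | no a≮B rewrite m≥n⇒m⊓n≡n (≮⇒≥ a≮B) | m≥n⇒m⊓n≡n (≤-trans (≮⇒≥ a≮B) (n≤1+n a)) =
  ∸-+-≤ x (B≤aB a (≮⇒≥ a≮B)) (m≤m+n B (a * B))
    (subst₂ _≤_ (sym (e₁ a B x)) (sym (e₂ a B)) (+-monoˡ-≤ (a * B + B) x≤B))
  where
  B≤aB : ∀ a → B ≤ a → B ≤ a * B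
  B≤aB zero    z≤n = z≤n
  B≤aB (suc a) _   = m≤m+n B (a * B)
  x≤B : x ≤ B
  x≤B = [ (λ x≡0 → subst (_≤ B) (sym x≡0) z≤n) , <⇒≤ ]′ hx
  e₁ : ∀ a B x → a * B + x + B ≡ x + (a * B + B)
  e₁ = solve-∀
  e₂ : ∀ a B → B + a * B + B ≡ B + (a * B + B)
  e₂ = solve-∀

bound-step : ∀ m a b x → x < m → (x ≡ 0 ⊎ x < b) → bound m a b + x ≤ bound m (suc a) b
bound-step m a b x x<m hx with a <? m
... | yes a<m rewrite m≤n⇒m⊓n≡m (<⇒≤ a<m) | m≤n⇒m⊓n≡m a<m | m≤n⇒m∸n≡0 (<⇒≤ a<m) | m≤n⇒m∸n≡0 a<m =
  subst₂ _≤_ (e K P x) (sym (+-identityʳ (K' + P')))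
    (+-mono-≤ (quadratic-step a B x x-small) (*-monoʳ-≤ (b ∸ m) (m∸n≤m a 1)))
  where
  B = b ⊓ m
  x-small : x ≡ 0 ⊎ x < B
  x-small = Sum.map₂ (λ x<b → ⊓-glb x<b x<m) hx
  K = a * B ∸ (a ⊓ B)
  P = (b ∸ m) * (a ∸ 1)
  K' = (B + a * B) ∸ (suc a ⊓ B)
  P' = (b ∸ m) * a
  e : ∀ K P x → K + x + P ≡ K + P + 0 + x
  e = solve-∀
... | no a≮m rewrite m≥n⇒m⊓n≡n (≮⇒≥ a≮m) | m≥n⇒m⊓n≡n (≤-trans (≮⇒≥ a≮m) (n≤1+n a)) | +-∸-assoc 1 (≮⇒≥ a≮m) =
  subst (bound' + x ≤_) (e X Y Z (B ∸ 1)) (+-monoʳ-≤ bound' x≤B∸1)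
  where
  B = b ⊓ m
  X = m * B ∸ (m ⊓ B)
  Y = (b ∸ m) * (m ∸ 1)
  Z = (a ∸ m) * (B ∸ 1)
  bound' = X + Y + Z
  x≤B∸1 : x ≤ B ∸ 1
  x≤B∸1 = [ (λ x≡0 → subst (_≤ B ∸ 1) (sym x≡0) z≤n)
          , (λ x<b → m+n≤o⇒m≤o∸n x (subst (_≤ B) (+-comm 1 x) (⊓-glb x<b x<m))) ]′ hx
  e : ∀ X Y Z W → X + Y + Z + W ≡ X + Y + (W + Z)
  e = solve-∀

-- The bound against a set of 2m - 1 columns (m = suc m₁, 2m - 1 = suc m₁ + m₁),
-- for at most m rows and for m + u₂ rows.

bound-few-rows : ∀ m₁ u → u ≤ suc m₁ → bound (suc m₁) u (suc m₁ + m₁) ≡ u * m₁ + m₁ * (u ∸ 1)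
bound-few-rows m₁ u u≤m
  rewrite m≤n⇒m⊓n≡m u≤m | m≥n⇒m⊓n≡n (m≤m+n (suc m₁) m₁) | m≤n⇒m⊓n≡m u≤m
        | m+n∸m≡n (suc m₁) m₁ | m≤n⇒m∸n≡0 u≤m | *-suc u m₁ | m+n∸m≡n u (u * m₁) = +-identityʳ _

bound-many-rows : ∀ m₁ u₂ → bound (suc m₁) (suc m₁ + u₂) (suc m₁ + m₁) ≡ suc m₁ * m₁ + m₁ * m₁ + u₂ * m₁
bound-many-rows m₁ u₂ = go (suc m₁) refl
  where
  go : ∀ m → m ≡ suc m₁ → bound m (m + u₂) (m + m₁) ≡ m * m₁ + m₁ * m₁ + u₂ * m₁
  go m m≡ rewrite m≥n⇒m⊓n≡n (m≤m+n m u₂) | m≥n⇒m⊓n≡n (m≤m+n m m₁) | ⊓-idem m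
                | m+n∸m≡n m m₁ | m+n∸m≡n m u₂ | m≡ | m+n∸m≡n m₁ (m₁ * suc m₁) | *-suc m₁ m₁ = refl

-- With m = suc m₁ and b = 2m - 1, the peeling leaves
--   peeled(u, y) = m + (b - u)·m + bound m u b + y
-- cells, where u ≤ b rows remain, y < m, and y = 0 or y < u.

peeled : ℕ → ℕ → ℕ → ℕ
peeled m₁ u y = suc m₁ + ((suc m₁ + m₁) ∸ u) * suc m₁ + bound (suc m₁) u (suc m₁ + m₁) + y

estimate-no-rows : ∀ k → peeled (suc k) 0 0 + 2 * suc (suc k) ≤ 3 * suc (suc k) * suc (suc k)
estimate-no-rows k rewrite bound-few-rows (suc k) 0 z≤n = ≤-trans (m≤m+n _ (suc (suc k) * k)) (≤-reflexive (slack k))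
  where
  slack : ∀ k → suc (suc k) + (suc (suc k) + suc k) * suc (suc k) + (0 + suc k * 0) + 0 + 2 * suc (suc k)
                + suc (suc k) * k ≡ 3 * suc (suc k) * suc (suc k)
  slack = solve-∀

columns-left : ∀ u′ v → suc (u′ + v) + (u′ + v) ∸ suc u′ ≡ v + (u′ + v)
columns-left u′ v = trans (cong (_∸ suc u′) (e u′ v)) (m+n∸n≡m (v + (u′ + v)) (suc u′))
  where
  e : ∀ u′ v → suc (u′ + v) + (u′ + v) ≡ v + (u′ + v) + suc u′
  e = solve-∀

estimate-few-rows : ∀ u′ v y → y ≤ u′ → peeled (u′ + v) (suc u′) y + 2 * suc (u′ + v) ≤ 3 * suc (u′ + v) * suc (u′ + v)
estimate-few-rows u′ v y y≤u′ with e , refl ← m≤n⇒∃[o]m+o≡n y≤u′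
  rewrite bound-few-rows (y + e + v) (suc (y + e)) (s≤s (m≤m+n (y + e) v)) | columns-left (y + e) v =
  ≤-trans (m≤m+n _ (e + ((y + e) * v + v * v))) (≤-reflexive (slack y e v))
  where
  slack : ∀ y e v →
    suc (y + e + v) + (v + (y + e + v)) * suc (y + e + v) + (suc (y + e) * (y + e + v) + (y + e + v) * (y + e))
    + y + 2 * suc (y + e + v) + (e + ((y + e) * v + v * v)) ≡ 3 * suc (y + e + v) * suc (y + e + v)
  slack = solve-∀

estimate-many-rows : ∀ u₂ r y → y ≤ u₂ + r →
  peeled (u₂ + r) (suc (u₂ + r) + u₂) y + 2 * suc (u₂ + r) ≤ 3 * suc (u₂ + r) * suc (u₂ + r)
estimate-many-rows u₂ r y y≤m₁ with e , y+e≡m₁ ← m≤n⇒∃[o]m+o≡n y≤m₁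
  rewrite bound-many-rows (u₂ + r) u₂ | [m+n]∸[m+o]≡n∸o (suc (u₂ + r)) (u₂ + r) u₂ | m+n∸m≡n u₂ r =
  ≤-trans (m≤m+n _ (u₂ + e)) (≤-reflexive (+-cancelʳ-≡ y _ _ slack))
  where
  m = suc (u₂ + r)
  lhs = m + r * m + (m * (u₂ + r) + (u₂ + r) * (u₂ + r) + u₂ * (u₂ + r)) + y + 2 * m
  slack : lhs + (u₂ + e) + y ≡ 3 * m * m + y
  slack = begin
    lhs + (u₂ + e) + y       ≡⟨ shuffle lhs u₂ e y ⟩
    lhs + (u₂ + (y + e))     ≡⟨ cong (λ z → lhs + (u₂ + z)) y+e≡m₁ ⟩
    lhs + (u₂ + (u₂ + r))    ≡⟨ poly u₂ r y ⟩
    3 * m * m + y            ∎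
    where
    open ≡-Reasoning
    shuffle : ∀ L u₂ e y → L + (u₂ + e) + y ≡ L + (u₂ + (y + e))
    shuffle = solve-∀
    poly : ∀ u₂ r y →
      suc (u₂ + r) + r * suc (u₂ + r) + (suc (u₂ + r) * (u₂ + r) + (u₂ + r) * (u₂ + r) + u₂ * (u₂ + r)) + y
      + 2 * suc (u₂ + r) + (u₂ + (u₂ + r)) ≡ 3 * suc (u₂ + r) * suc (u₂ + r) + y
    poly = solve-∀

estimate : ∀ m₁ u y → 1 ≤ m₁ → u ≤ suc m₁ + m₁ → y < suc m₁ → (y ≡ 0 ⊎ y < u) →
  peeled m₁ u y + 2 * suc m₁ ≤ 3 * suc m₁ * suc m₁
estimate m₁ u y 1≤m₁ u≤b y<m hy with u ≤? suc m₁
estimate (suc k) zero .0 _ _ _ (inj₁ refl) | yes _ = estimate-no-rows k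
estimate m₁ (suc u′) y _ _ _ hy | yes (s≤s u′≤m₁) with v , refl ← m≤n⇒∃[o]m+o≡n u′≤m₁ =
  estimate-few-rows u′ v y (y≤u′ hy)
  where
  y≤u′ : (y ≡ 0 ⊎ y < suc u′) → y ≤ u′
  y≤u′ (inj₁ refl) = z≤n
  y≤u′ (inj₂ (s≤s y≤u′)) = y≤u′
estimate m₁ u y _ u≤b y<m _ | no m≰u with u₂ , refl ← m≤n⇒∃[o]m+o≡n (<⇒≤ (≰⇒> m≰u))
  with r , refl ← m≤n⇒∃[o]m+o≡n (+-cancelˡ-≤ (suc m₁) u₂ m₁ u≤b) = estimate-many-rows u₂ r y (≤-pred y<m)

2m∸1 : ∀ m₁ → 2 * suc m₁ ∸ 1 ≡ suc m₁ + m₁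
2m∸1 m₁ = trans (cong (m₁ +_) (*-identityˡ (suc m₁))) (+-suc m₁ m₁)

final-estimate : ∀ m u y → 2 ≤ m → u ≤ 2 * m ∸ 1 → y < m → (y ≡ 0 ⊎ y < u) →
  m + ((2 * m ∸ 1) ∸ u) * m + bound m u (2 * m ∸ 1) + y ≤ 3 * m * m ∸ 2 * m
final-estimate (suc m₁) u y (s≤s 1≤m₁) u≤b y<m hy =
  m+n≤o⇒m≤o∸n _ (subst P (sym (2m∸1 m₁)) (estimate m₁ u y 1≤m₁ (subst (u ≤_) (2m∸1 m₁) u≤b) y<m hy))
  where
  P : ℕ → Set
  P b = suc m₁ + (b ∸ u) * suc m₁ + bound (suc m₁) u b + y + 2 * suc m₁ ≤ 3 * suc m₁ * suc m₁

-- Read a 0/1 matrix M as a bipartite digraph, and compare it with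
-- N: a cell where M = 1, N = 0 is an edge row → column (d⁺), a cell where
-- M = 0, N = 1 an edge column → row (d⁻).  If M and N have the same row and
-- column counts, every vertex has as many d-edges in as out, so for any set
-- of rows RS and columns KS as many d-edges leave the set as enter it.

module Balance {n} (M N : Matrix n)
  (rows : ∀ i → count (M i) ≡ count (N i))
  (cols : ∀ j → count (λ i → M i j) ≡ count (λ i → N i j))
  (RS KS : Fin n → Bool) where

  d⁺ d⁻ : Fin n → Fin n → Bool
  d⁺ i j = M i j ∧ not (N i j)
  d⁻ i j = not (M i j) ∧ N i j

  exits⁺ exits⁻ enters⁺ enters⁻ : ℕ
  exits⁺  = cells (λ i j → (RS i ∧ d⁺ i j) ∧ not (KS j))
  enters⁻ = cells (λ i j → (RS i ∧ d⁻ i j) ∧ not (KS j))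
  enters⁺ = cells (λ j i → (KS j ∧ d⁺ i j) ∧ not (RS i))
  exits⁻  = cells (λ j i → (KS j ∧ d⁻ i j) ∧ not (RS i))

  inner : (Fin n → Fin n → Bool) → ℕ
  inner d = cells (λ i j → (RS i ∧ d i j) ∧ KS j)

  row-balance : cells (λ i j → RS i ∧ d⁺ i j) ≡ cells (λ i j → RS i ∧ d⁻ i j)
  row-balance = sum-cong-≗ per-row
    where
    per-row : ∀ i → count (λ j → RS i ∧ d⁺ i j) ≡ count (λ j → RS i ∧ d⁻ i j)
    per-row i with RS i
    ... | true  = count-diff (M i) (N i) (rows i)
    ... | false = refl

  col-balance : cells (λ j i → KS j ∧ d⁺ i j) ≡ cells (λ j i → KS j ∧ d⁻ i j)
  col-balance = sum-cong-≗ per-col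
    where
    per-col : ∀ j → count (λ i → KS j ∧ d⁺ i j) ≡ count (λ i → KS j ∧ d⁻ i j)
    per-col j with KS j
    ... | true  = count-diff (λ i → M i j) (λ i → N i j) (cols j)
    ... | false = refl

  row-split : ∀ d → cells (λ i j → RS i ∧ d i j) ≡ inner d + cells (λ i j → (RS i ∧ d i j) ∧ not (KS j))
  row-split d = cells-split (λ i j → RS i ∧ d i j) (λ _ j → KS j)

  col-split : ∀ d → cells (λ j i → KS j ∧ d i j) ≡ inner d + cells (λ j i → (KS j ∧ d i j) ∧ not (RS i))
  col-split d = begin
    cells (λ j i → KS j ∧ d i j)
      ≡⟨ cells-split (λ j i → KS j ∧ d i j) (λ _ i → RS i) ⟩
    cells (λ j i → (KS j ∧ d i j) ∧ RS i) + outside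
      ≡⟨ cong (_+ outside) (trans (cells-transpose (λ j i → (KS j ∧ d i j) ∧ RS i)) (cells-cong (λ i j → ∧-rotate (KS j) (d i j) (RS i)))) ⟩
    inner d + outside ∎
    where
    open ≡-Reasoning
    outside = cells (λ j i → (KS j ∧ d i j) ∧ not (RS i))

  balance : exits⁺ + exits⁻ ≡ enters⁺ + enters⁻
  balance = +-cancelˡ-≡ (inner d⁺ + inner d⁻) _ _ (begin
    (inner d⁺ + inner d⁻) + (exits⁺ + exits⁻)   ≡⟨ interchange (inner d⁺) (inner d⁻) exits⁺ exits⁻ ⟩
    (inner d⁺ + exits⁺) + (inner d⁻ + exits⁻)   ≡⟨ cong₂ _+_ rows-eq (sym cols-eq) ⟩
    (inner d⁻ + enters⁻) + (inner d⁺ + enters⁺) ≡⟨ interchange′ (inner d⁻) enters⁻ (inner d⁺) enters⁺ ⟩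
    (inner d⁺ + inner d⁻) + (enters⁺ + enters⁻) ∎)
    where
    open ≡-Reasoning
    rows-eq : inner d⁺ + exits⁺ ≡ inner d⁻ + enters⁻
    rows-eq = trans (sym (row-split d⁺)) (trans row-balance (row-split d⁻))
    cols-eq : inner d⁺ + enters⁺ ≡ inner d⁻ + exits⁻
    cols-eq = trans (sym (col-split d⁺)) (trans col-balance (col-split d⁻))
    interchange : ∀ a b c d → (a + b) + (c + d) ≡ (a + c) + (b + d)
    interchange = solve-∀
    interchange′ : ∀ a b c d → (a + b) + (c + d) ≡ (c + a) + (d + b)
    interchange′ = solve-∀

module Orbits {n} (t : Fin n → Fin n) where

  iter : ℕ → Fin n → Fin n
  iter zero    i = i
  iter (suc k) i = t (iter k i)

  iter-+ : ∀ a b i → iter (a + b) i ≡ iter a (iter b i)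
  iter-+ zero    b i = refl
  iter-+ (suc a) b i = cong t (iter-+ a b i)

  iter-t : ∀ k i → iter k (t i) ≡ t (iter k i)
  iter-t zero    i = refl
  iter-t (suc k) i = cong t (iter-t k i)

  iter-period : ∀ p i → iter (suc p) i ≡ i → ∀ k → iter (k * suc p) i ≡ i
  iter-period p i e zero    = refl
  iter-period p i e (suc k) = trans (iter-+ (suc p) (k * suc p) i) (trans (cong (iter (suc p)) (iter-period p i e k)) e)

  Periodic : Fin n → Set
  Periodic i = ∃ λ p → p < n × iter (suc p) i ≡ i

  periodic? : Fin n → Bool
  periodic? i = exists {n} (λ k → iter (suc (toℕ k)) i == i)

  periodic?-sound : ∀ i → periodic? i ≡ true → Periodic i
  periodic?-sound i e = let (k , fixes) = exists-sound (λ k → iter (suc (toℕ k)) i == i) e in toℕ k , toℕ<n k , ==-sound _ _ fixes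

  periodic?-complete : ∀ i → Periodic i → periodic? i ≡ true
  periodic?-complete i (p , p<n , fixes) = exists-complete (λ k → iter (suc (toℕ k)) i == i) (fromℕ< p<n)
    (subst (λ q → (iter (suc q) i == i) ≡ true) (sym (toℕ-fromℕ< p<n)) (trans (cong (_== i) fixes) (==-refl i)))

  periodic-t : ∀ i → Periodic i → Periodic (t i)
  periodic-t i (p , p<n , fixes) = p , p<n , trans (iter-t (suc p) i) (cong t fixes)

  periodic-pred : ∀ i → (per : Periodic i) → Periodic (iter (proj₁ per) i) × t (iter (proj₁ per) i) ≡ i
  periodic-pred i (p , p<n , fixes) = (p , p<n , cycle) , fixes
    where
    cycle : iter (suc p) (iter p i) ≡ iter p i
    cycle = begin
      iter (suc p) (iter p i) ≡⟨ sym (iter-+ (suc p) p i) ⟩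
      iter (suc p + p) i      ≡⟨ cong (λ k → iter k i) (+-comm (suc p) p) ⟩
      iter (p + suc p) i      ≡⟨ iter-+ p (suc p) i ⟩
      iter p (iter (suc p) i) ≡⟨ cong (iter p) fixes ⟩
      iter p i                ∎
      where open ≡-Reasoning

  -- periodic points with equal images coincide: iterate to a common multiple of the periods
  periodic-injective : ∀ r r′ → Periodic r → Periodic r′ → t r ≡ t r′ → r ≡ r′
  periodic-injective r r′ (p , _ , fixes) (p′ , _ , fixes′) same = begin
    r                           ≡⟨ sym (iter-period p r fixes (suc p′)) ⟩
    iter (suc L) r              ≡⟨ sym (iter-t L r) ⟩
    iter L (t r)                ≡⟨ cong (iter L) same ⟩
    iter L (t r′)               ≡⟨ iter-t L r′ ⟩
    iter (suc p′ * suc p) r′    ≡⟨ cong (λ k → iter k r′) (*-comm (suc p′) (suc p)) ⟩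
    iter (suc p * suc p′) r′    ≡⟨ iter-period p′ r′ fixes′ (suc p) ⟩
    r′                          ∎
    where
    open ≡-Reasoning
    L = p + p′ * suc p

  -- among t⁰ i, …, tⁿ i two coincide, so the orbit of i reaches a periodic point
  periodic-reached : ∀ i → ∃ λ k → Periodic (iter k i)
  periodic-reached i with a , b , a<b , same ← pigeonhole (n<1+n n) (λ (k : Fin (suc n)) → iter (toℕ k) i)
    with p , b≡ ← m≤n⇒∃[o]m+o≡n a<b =
    toℕ a , p , p<n , cycle
    where
    p<n : p < n
    p<n = ≤-trans (s≤s (m≤n+m p (toℕ a))) (subst (_≤ n) (sym b≡) (≤-pred (toℕ<n b)))
    span : suc p + toℕ a ≡ toℕ b
    span = trans (cong suc (+-comm p (toℕ a))) b≡
    cycle : iter (suc p) (iter (toℕ a) i) ≡ iter (toℕ a) i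
    cycle = begin
      iter (suc p) (iter (toℕ a) i) ≡⟨ sym (iter-+ (suc p) (toℕ a) i) ⟩
      iter (suc p + toℕ a) i        ≡⟨ cong (λ k → iter k i) span ⟩
      iter (toℕ b) i                ≡⟨ sym same ⟩
      iter (toℕ a) i                ∎
      where open ≡-Reasoning

-- A line (row or column) is a
-- vector Mv with m ones, Cv marks its critical cells and K a set of
-- positions.

module SinkLine {n} (m : ℕ) (Mv Cv K : Fin n → Bool) (ones : count Mv ≡ m)
  (ones-critical : ∀ j → K j ≡ true → Mv j ≡ true → Cv j ≡ true)
  (zeros-free : ∀ j → K j ≡ true → Mv j ≡ false → Cv j ≡ false)
  (free-zero-exists : (∃ λ j → Mv j ≡ true × Cv j ≡ true) → ∃ λ j → Mv j ≡ false × Cv j ≡ false)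
  (zeros-free-if-ones-critical : (∀ j → Mv j ≡ true → Cv j ≡ true) → ∀ j → Mv j ≡ false → Cv j ≡ false)
  (free-zeros-inside : ∀ j → Mv j ≡ false → Cv j ≡ false → K j ≡ true) where

  x : ℕ
  x = count (λ j → K j ∧ Cv j)

  ones-inside : Fin n → Bool
  ones-inside j = K j ∧ Mv j

  x≡ones-inside : x ≡ count ones-inside
  x≡ones-inside = count-cong same
    where
    same : ∀ j → (K j ∧ Cv j) ≡ (K j ∧ Mv j)
    same j with K j in k | Mv j in mv
    ... | false | _     = refl
    ... | true  | true  = ones-critical j k mv
    ... | true  | false = zeros-free j k mv

  ones-inside⊆ones : ones-inside ⊆ᵇ Mv
  ones-inside⊆ones j e = proj₂ (∧-true e)

  ones-inside⊆K : ones-inside ⊆ᵇ K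
  ones-inside⊆K j e = proj₁ (∧-true e)

  x≤m : x ≤ m
  x≤m = subst₂ _≤_ (sym x≡ones-inside) ones (count-mono ones-inside⊆ones)

  -- a critical one inside K comes with a free zero, which lies in K too
  x<K : 1 ≤ x → x < count K
  x<K 1≤x with j , pos ← ∑-pos (λ j → ι (K j ∧ Cv j)) 1≤x
    with k , c ← ∧-true (ι-positive pos)
    with j′ , m₀ , c₀ ← free-zero-exists (j , ¬-not (λ mv → not-¬ c (zeros-free j k mv)) , c) =
    subst (_< count K) (sym x≡ones-inside)
      (count-strict j′ ones-inside⊆K (free-zeros-inside j′ m₀ c₀) (trans (cong (K j′ ∧_) m₀) (∧-zeroʳ (K j′))))

  -- if all m ones are inside K and critical, every zero is free, hence in K
  x≡m : x ≡ m → count K ≡ n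
  x≡m e = count-all K inside
    where
    ones⊆ones-inside : Mv ⊆ᵇ ones-inside
    ones⊆ones-inside = count-eq-⊇ ones-inside⊆ones (trans (sym x≡ones-inside) (trans e (sym ones)))
    all-critical : ∀ j → Mv j ≡ true → Cv j ≡ true
    all-critical j mv = ones-critical j (proj₁ (∧-true (ones⊆ones-inside j mv))) mv
    inside : ∀ j → K j ≡ true
    inside j with Mv j in mv
    ... | true  = proj₁ (∧-true (ones⊆ones-inside j mv))
    ... | false = free-zeros-inside j mv (zeros-free-if-ones-critical all-critical j mv)

-- A cell is free if it is not in C; the
-- free cells are the edges of M's digraph (row → column where M = 1,
-- column → row where M = 0), the only places where another matrix
-- containing C could differ from M.

module Critical (m : ℕ) (M : Matrix (2 * m)) (M∈Λ : InΛ (2 * m) m M)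
                (C : PosSet (2 * m)) (critical : IsCritical m M C) where

  n : ℕ
  n = 2 * m

  row-count : ∀ {N} → InΛ n m N → ∀ i → count (N i) ≡ m
  row-count {N} N∈Λ i = trans (sym (countTrue≡count (N i))) (proj₁ N∈Λ i)

  col-count : ∀ {N} → InΛ n m N → ∀ j → count (λ i → N i j) ≡ m
  col-count {N} N∈Λ j = trans (sym (countTrue≡count (λ i → N i j))) (proj₂ N∈Λ j)

  defining : IsDefining m M C
  defining = proj₁ critical

  -- (RS, KS) is forward closed if no free edge leaves it
  ForwardClosed : (Fin n → Bool) → (Fin n → Bool) → Set
  ForwardClosed RS KS = ∀ i j → C i j ≡ false →
    (M i j ≡ true → RS i ≡ true → KS j ≡ true) × (M i j ≡ false → KS j ≡ true → RS i ≡ true)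

  data Enters (RS KS : Fin n → Bool) (i j : Fin n) : Set where
    row→col : M i j ≡ true  → RS i ≡ false → KS j ≡ true → Enters RS KS i j
    col→row : M i j ≡ false → KS j ≡ false → RS i ≡ true → Enters RS KS i j

  entering-row : ∀ {RS KS i j} → Enters RS KS i j → M i j ≡ true → RS i ≡ false
  entering-row (row→col _ r _) _  = r
  entering-row (col→row m₀ _ _) m₁ = ⊥-elim (not-¬ m₁ m₀)

  entering-col : ∀ {RS KS i j} → Enters RS KS i j → M i j ≡ false → KS j ≡ false
  entering-col (row→col m₁ _ _) m₀ = ⊥-elim (not-¬ m₁ m₀)
  entering-col (col→row _ k _) _  = k

  -- A matrix N ∈ Λ that differs from M only at free cells and at one cell
  -- (i₀, j₀) — where it does differ — cannot exist if (i₀, j₀) enters a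
  -- forward closed set: by balance, the d-edge (i₀, j₀) entering the set
  -- would need a d-edge leaving it, and those are free edges of M, which
  -- closedness forbids.
  no-entering-switch : ∀ {RS KS i₀ j₀} (N : Matrix n) → InΛ n m N →
    (∀ i j → N i j ≡ not (M i j) → C i j ≡ false ⊎ (i ≡ i₀ × j ≡ j₀)) →
    N i₀ j₀ ≡ not (M i₀ j₀) → ForwardClosed RS KS → Enters RS KS i₀ j₀ → ⊥
  no-entering-switch {RS} {KS} {i₀} {j₀} N N∈Λ differs switched closed enters =
    <-irrefl refl (subst (1 ≤_) (trans (sym balance) no-exits) some-entry)
    where
    open Balance M N (λ i → trans (row-count M∈Λ i) (sym (row-count N∈Λ i)))
                     (λ j → trans (col-count M∈Λ j) (sym (col-count N∈Λ j))) RS KS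

    exit⁺-impossible : ∀ i j → RS i ≡ true → d⁺ i j ≡ true → KS j ≡ false → ⊥
    exit⁺-impossible i j r d k with ∧-true d
    ... | m₁ , n₀ with differs i j (trans (not-true n₀) (cong not (sym m₁)))
    ...   | inj₁ free = not-¬ (proj₁ (closed i j free) m₁ r) k
    ...   | inj₂ (refl , refl) = not-¬ r (entering-row enters m₁)

    exit⁻-impossible : ∀ i j → KS j ≡ true → d⁻ i j ≡ true → RS i ≡ false → ⊥
    exit⁻-impossible i j k d r with ∧-true d
    ... | m₀ , n₁ with differs i j (trans n₁ (cong not (sym (not-true m₀))))
    ...   | inj₁ free = not-¬ (proj₂ (closed i j free) (not-true m₀) k) r
    ...   | inj₂ (refl , refl) = not-¬ k (entering-col enters (not-true m₀))

    no-exit⁺ : ∀ i j → (RS i ∧ d⁺ i j) ∧ not (KS j) ≡ false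
    no-exit⁺ i j = ¬-not λ e →
      let (rd , k) = ∧-true {RS i ∧ d⁺ i j} e in
      exit⁺-impossible i j (proj₁ (∧-true {RS i} rd)) (proj₂ (∧-true {RS i} rd)) (not-true k)

    no-exit⁻ : ∀ j i → (KS j ∧ d⁻ i j) ∧ not (RS i) ≡ false
    no-exit⁻ j i = ¬-not λ e →
      let (kd , r) = ∧-true {KS j ∧ d⁻ i j} e in
      exit⁻-impossible i j (proj₁ (∧-true {KS j} kd)) (proj₂ (∧-true {KS j} kd)) (not-true r)

    no-exits : exits⁺ + exits⁻ ≡ 0
    no-exits = cong₂ _+_ (cells-none (λ i j → (RS i ∧ d⁺ i j) ∧ not (KS j)) no-exit⁺)
                         (cells-none (λ j i → (KS j ∧ d⁻ i j) ∧ not (RS i)) no-exit⁻)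

    some-entry : 1 ≤ enters⁺ + enters⁻
    some-entry = entering enters
      where
      entering : Enters RS KS i₀ j₀ → 1 ≤ enters⁺ + enters⁻
      entering (row→col m₁ r₀ k₀) = ≤-trans (cells-pos (λ j i → (KS j ∧ d⁺ i j) ∧ not (RS i)) j₀ i₀ entry) (m≤m+n enters⁺ enters⁻)
        where
        entry : (KS j₀ ∧ d⁺ i₀ j₀) ∧ not (RS i₀) ≡ true
        entry rewrite k₀ | m₁ | switched | r₀ = refl
      entering (col→row m₀ k₀ r₀) = ≤-trans (cells-pos (λ i j → (RS i ∧ d⁻ i j) ∧ not (KS j)) i₀ j₀ entry) (m≤n+m enters⁻ enters⁺)
        where
        entry : (RS i₀ ∧ d⁻ i₀ j₀) ∧ not (KS j₀) ≡ true
        entry rewrite r₀ | m₀ | switched | k₀ = refl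

  -- Otherwise C without that cell
  -- would still be defining: a completion differing from M would have to
  -- switch the cell, which `no-entering-switch` forbids.
  critical-cells-stay-out : ∀ {RS KS i₀ j₀} → C i₀ j₀ ≡ true → ForwardClosed RS KS → Enters RS KS i₀ j₀ → ⊥
  critical-cells-stay-out {RS} {KS} {i₀} {j₀} c₀ closed enters = proj₂ critical D (D⊆C , C⊈D) D-defining
    where
    here : Fin n → Fin n → Bool
    here i j = (i == i₀) ∧ (j == j₀)

    D : PosSet n
    D i j = C i j ∧ not (here i j)

    D⊆C : D ⊆ₚ C
    D⊆C i j t = Equivalence.from T-≡ (proj₁ (∧-true (Equivalence.to T-≡ t)))

    C⊈D : ¬ (C ⊆ₚ D)
    C⊈D C⊆D = subst T D-here (C⊆D i₀ j₀ (Equivalence.from T-≡ c₀))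
      where
      D-here : D i₀ j₀ ≡ false
      D-here rewrite ==-refl i₀ | ==-refl j₀ = ∧-zeroʳ (C i₀ j₀)

    D-defining : IsDefining m M D
    D-defining N N∈Λ N⊇D = defining N N∈Λ N⊇C
      where
      agree : ∀ i j → C i j ≡ true → here i j ≡ false → N i j ≡ M i j
      agree i j c h = N⊇D i j (Equivalence.from T-≡ (cong₂ (λ a b → a ∧ not b) c h))

      differs : ∀ i j → N i j ≡ not (M i j) → C i j ≡ false ⊎ (i ≡ i₀ × j ≡ j₀)
      differs i j e with C i j in c | here i j in h
      ... | false | _     = inj₁ refl
      ... | true  | false = ⊥-elim (not-¬ (agree i j c h) e)
      ... | true  | true  = let (hi , hj) = ∧-true h in inj₂ (==-sound i i₀ hi , ==-sound j j₀ hj)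

      at-cell : N i₀ j₀ ≡ M i₀ j₀
      at-cell with N i₀ j₀ Bool.≟ M i₀ j₀
      ... | yes e = e
      ... | no  e = ⊥-elim (no-entering-switch N N∈Λ differs (¬-not e) closed enters)

      N⊇C : Contains M C N
      N⊇C i j t with here i j in h
      ... | false = agree i j (Equivalence.to T-≡ t) h
      ... | true  = let (hi , hj) = ∧-true h in
                    subst₂ (λ a b → N a b ≡ M a b) (sym (==-sound i i₀ hi)) (sym (==-sound j j₀ hj)) at-cell

  critical-one : ∀ {RS KS i j} → C i j ≡ true → M i j ≡ true → ForwardClosed RS KS → KS j ≡ true → RS i ≡ true
  critical-one {RS} {i = i} c m₁ closed k with RS i in r
  ... | true  = refl
  ... | false = ⊥-elim (critical-cells-stay-out c closed (row→col m₁ r k))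

  critical-zero : ∀ {RS KS i j} → C i j ≡ true → M i j ≡ false → ForwardClosed RS KS → RS i ≡ true → KS j ≡ true
  critical-zero {KS = KS} {j = j} c m₀ closed r with KS j in k
  ... | true  = refl
  ... | false = ⊥-elim (critical-cells-stay-out c closed (col→row m₀ k r))

  free-one : (Fin n → Bool) → Fin n → Fin n → Bool
  free-one K i j = K j ∧ (M i j ∧ not (C i j))

  free-zero : (Fin n → Bool) → Fin n → Fin n → Bool
  free-zero R j i = R i ∧ (not (M i j) ∧ not (C i j))

  -- Suppose every row of R has a free 1-edge into K and
  -- every column of K a free 0-edge into R.  Choose one such edge s i from
  -- each row and s′ j from each column; t = s′ ∘ s maps R to itself and so
  -- has cyclic rows.  Switching M along all the chosen edges on these
  -- cycles changes each row and column either nowhere or in one 1 and one 0,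
  -- and touches no cell of C, so yields another completion of C: R is empty.
  module FreeCycles (R K : Fin n → Bool) (default : Fin n)
    (row-out : ∀ i → R i ≡ true → ∃ λ j → free-one K i j ≡ true)
    (col-out : ∀ j → K j ≡ true → ∃ λ i → free-zero R j i ≡ true) where

    s s′ : Fin n → Fin n
    s  i = choose default (free-one K i)
    s′ j = choose default (free-zero R j)

    s-edge : ∀ i → R i ≡ true → K (s i) ≡ true × M i (s i) ≡ true × C i (s i) ≡ false
    s-edge i r = proj₁ edge , proj₁ (∧-true (proj₂ edge)) , not-true (proj₂ (∧-true {M i (s i)} (proj₂ edge)))
      where edge = ∧-true (choose-spec default (free-one K i) (row-out i r))

    s′-edge : ∀ j → K j ≡ true → R (s′ j) ≡ true × M (s′ j) j ≡ false × C (s′ j) j ≡ false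
    s′-edge j k = proj₁ edge , not-true (proj₁ (∧-true (proj₂ edge))) , not-true (proj₂ (∧-true {not (M (s′ j) j)} (proj₂ edge)))
      where edge = ∧-true (choose-spec default (free-zero R j) (col-out j k))

    t : Fin n → Fin n
    t i = s′ (s i)

    open Orbits t

    t-R : ∀ i → R i ≡ true → R (t i) ≡ true
    t-R i r = proj₁ (s′-edge (s i) (proj₁ (s-edge i r)))

    iter-R : ∀ k i → R i ≡ true → R (iter k i) ≡ true
    iter-R zero    i r = r
    iter-R (suc k) i r = t-R _ (iter-R k i r)

    cyclic : Fin n → Bool
    cyclic i = R i ∧ periodic? i

    cyclic-R : ∀ i → cyclic i ≡ true → R i ≡ true
    cyclic-R i c = proj₁ (∧-true c)

    cyclic-periodic : ∀ i → cyclic i ≡ true → Periodic i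
    cyclic-periodic i c = periodic?-sound i (proj₂ (∧-true {R i} c))

    cyclic-intro : ∀ i → R i ≡ true → Periodic i → cyclic i ≡ true
    cyclic-intro i r per = cong₂ _∧_ r (periodic?-complete i per)

    cyclic-t : ∀ i → cyclic i ≡ true → cyclic (t i) ≡ true
    cyclic-t i c = cyclic-intro (t i) (t-R i (cyclic-R i c)) (periodic-t i (cyclic-periodic i c))

    cyclic-pred : ∀ i → cyclic i ≡ true → ∃ λ r → cyclic r ≡ true × t r ≡ i
    cyclic-pred i c = iter p i , cyclic-intro (iter p i) (iter-R p i (cyclic-R i c)) (proj₁ preimage) , proj₂ preimage
      where
      per = cyclic-periodic i c
      p = proj₁ per
      preimage = periodic-pred i per

    cyclic-injective : ∀ r r′ → cyclic r ≡ true → cyclic r′ ≡ true → t r ≡ t r′ → r ≡ r′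
    cyclic-injective r r′ c c′ = periodic-injective r r′ (cyclic-periodic r c) (cyclic-periodic r′ c′)

    cyclic-exists : ∀ i → R i ≡ true → ∃ λ r → cyclic r ≡ true
    cyclic-exists i r = iter k i , cyclic-intro (iter k i) (iter-R k i r) (proj₂ (periodic-reached i))
      where k = proj₁ (periodic-reached i)

    used : Fin n → Bool
    used j = exists (λ r → cyclic r ∧ (s r == j))

    used-sound : ∀ j → used j ≡ true → ∃ λ r → cyclic r ≡ true × s r ≡ j
    used-sound j u = r , proj₁ (∧-true e) , ==-sound (s r) j (proj₂ (∧-true {cyclic r} e))
      where
      r = proj₁ (exists-sound (λ r → cyclic r ∧ (s r == j)) u)
      e = proj₂ (exists-sound (λ r → cyclic r ∧ (s r == j)) u)

    used-intro : ∀ j r → cyclic r ≡ true → s r ≡ j → used j ≡ true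
    used-intro j r c refl = exists-complete (λ r → cyclic r ∧ (s r == j)) r (cong₂ _∧_ c (==-refl (s r)))

    -- the switched cells: the chosen edges on the cycles of t
    switch : Fin n → Fin n → Bool
    switch i j = (cyclic i ∧ (s i == j)) ∨ (used j ∧ (s′ j == i))

    N : Matrix n
    N i j = M i j xor switch i j

    entering-column : ∀ i r₀ → cyclic r₀ ≡ true → t r₀ ≡ i → ∀ j → (used j ∧ (s′ j == i)) ≡ (j == s r₀)
    entering-column i r₀ c₀ tr₀ j with j == s r₀ in e
    ... | true rewrite ==-sound j (s r₀) e =
      cong₂ _∧_ (used-intro (s r₀) r₀ c₀ refl) (trans (cong (_== i) tr₀) (==-refl i))
    ... | false with used j in u | s′ j == i in e′
    ...   | false | _     = refl
    ...   | true  | false = ∧-zeroʳ true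
    ...   | true  | true  = ⊥-elim (not-¬ (trans (cong (_== s r₀) (trans (sym sr) (cong s r≡r₀))) (==-refl (s r₀))) e)
      where
      r = proj₁ (used-sound j u)
      sr : s r ≡ j
      sr = proj₂ (proj₂ (used-sound j u))
      r≡r₀ : r ≡ r₀
      r≡r₀ = cyclic-injective r r₀ (proj₁ (proj₂ (used-sound j u))) c₀
               (trans (cong s′ sr) (trans (==-sound (s′ j) i e′) (sym tr₀)))

    acyclic-row : ∀ i → cyclic i ≡ false → ∀ j → switch i j ≡ false
    acyclic-row i c j rewrite c with used j in u | s′ j == i in e
    ... | false | _     = refl
    ... | true  | false = refl
    ... | true  | true  = ⊥-elim (not-¬ (subst (λ x → cyclic x ≡ true) t-r≡i (cyclic-t r cr)) c)
      where
      r = proj₁ (used-sound j u)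
      cr = proj₁ (proj₂ (used-sound j u))
      t-r≡i : t r ≡ i
      t-r≡i = trans (cong s′ (proj₂ (proj₂ (used-sound j u)))) (==-sound (s′ j) i e)

    leaving-row : ∀ j r → cyclic r ≡ true → s r ≡ j → ∀ i → (cyclic i ∧ (s i == j)) ≡ (i == r)
    leaving-row j r c sr i with i == r in e
    ... | true rewrite ==-sound i r e = cong₂ _∧_ c (trans (cong (_== j) sr) (==-refl j))
    ... | false with cyclic i in cᵢ | s i == j in e′
    ...   | false | _     = refl
    ...   | true  | false = refl
    ...   | true  | true  = ⊥-elim (not-¬ (trans (cong (_== r) i≡r) (==-refl r)) e)
      where
      i≡r : i ≡ r
      i≡r = cyclic-injective i r cᵢ c (cong s′ (trans (==-sound (s i) j e′) (sym sr)))

    unused-column : ∀ j → used j ≡ false → ∀ i → switch i j ≡ false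
    unused-column j u i rewrite u with cyclic i in c | s i == j in e
    ... | false | _     = refl
    ... | true  | false = refl
    ... | true  | true  = ⊥-elim (not-¬ (used-intro j i c (==-sound (s i) j e)) u)

    row-counts : ∀ i → count (N i) ≡ m
    row-counts i = by-cases (cyclic i) refl
      where
      by-cases : ∀ b → cyclic i ≡ b → count (N i) ≡ m
      by-cases false c = trans (count-cong (λ j → trans (cong (M i j xor_) (acyclic-row i c j)) (xor-identityʳ (M i j))))
                               (row-count M∈Λ i)
      by-cases true c = trans (count-flip (M i) (switch i) (s i) q (proj₁ (proj₂ (s-edge i (cyclic-R i c)))) M-iq marks)
                              (row-count M∈Λ i)
        where
        r₀ = proj₁ (cyclic-pred i c)
        c₀ = proj₁ (proj₂ (cyclic-pred i c))
        tr₀ : t r₀ ≡ i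
        tr₀ = proj₂ (proj₂ (cyclic-pred i c))
        q = s r₀
        M-iq : M i q ≡ false
        M-iq = subst (λ x → M x q ≡ false) tr₀ (proj₁ (proj₂ (s′-edge q (proj₁ (s-edge r₀ (cyclic-R r₀ c₀))))))
        marks : ∀ j → switch i j ≡ ((j == s i) ∨ (j == q))
        marks j = cong₂ _∨_ (trans (cong (_∧ (s i == j)) c) (==-sym (s i) j)) (entering-column i r₀ c₀ tr₀ j)

    col-counts : ∀ j → count (λ i → N i j) ≡ m
    col-counts j = by-cases (used j) refl
      where
      by-cases : ∀ b → used j ≡ b → count (λ i → N i j) ≡ m
      by-cases false u = trans (count-cong (λ i → trans (cong (M i j xor_) (unused-column j u i)) (xor-identityʳ (M i j))))
                               (col-count M∈Λ j)
      by-cases true u = trans (count-flip (λ i → M i j) (λ i → switch i j) r (s′ j) M-rj M-s′j marks)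
                              (col-count M∈Λ j)
        where
        r = proj₁ (used-sound j u)
        c = proj₁ (proj₂ (used-sound j u))
        sr : s r ≡ j
        sr = proj₂ (proj₂ (used-sound j u))
        M-rj : M r j ≡ true
        M-rj = subst (λ x → M r x ≡ true) sr (proj₁ (proj₂ (s-edge r (cyclic-R r c))))
        M-s′j : M (s′ j) j ≡ false
        M-s′j = proj₁ (proj₂ (s′-edge j (subst (λ x → K x ≡ true) sr (proj₁ (s-edge r (cyclic-R r c))))))
        marks : ∀ i → switch i j ≡ ((i == r) ∨ (i == s′ j))
        marks i = cong₂ _∨_ (leaving-row j r c sr i) (trans (cong (_∧ (s′ j == i)) u) (==-sym (s′ j) i))

    switch-free : ∀ i j → C i j ≡ true → switch i j ≡ false
    switch-free i j c = ¬-not λ sw → [ first , second ]′ (∨-true sw)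
      where
      first : (cyclic i ∧ (s i == j)) ≡ true → ⊥
      first e = let (cᵢ , sj) = ∧-true e in
        not-¬ c (subst (λ x → C i x ≡ false) (==-sound (s i) j sj) (proj₂ (proj₂ (s-edge i (cyclic-R i cᵢ)))))
      second : (used j ∧ (s′ j == i)) ≡ true → ⊥
      second e = let (u , s′i) = ∧-true e ; (r , cr , sr) = used-sound j u in
        not-¬ c (subst (λ x → C x j ≡ false) (==-sound (s′ j) i s′i)
                  (proj₂ (proj₂ (s′-edge j (subst (λ x → K x ≡ true) sr (proj₁ (s-edge r (cyclic-R r cr))))))))

    N∈Λ : InΛ n m N
    N∈Λ = (λ i → trans (countTrue≡count (N i)) (row-counts i))
        , (λ j → trans (countTrue≡count (λ i → N i j)) (col-counts j))

    N⊇C : Contains M C N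
    N⊇C i j c = trans (cong (M i j xor_) (switch-free i j (Equivalence.to T-≡ c))) (xor-identityʳ (M i j))

    no-free-cycle : ∀ i → R i ≡ true → ⊥
    no-free-cycle i r with r₀ , c₀ ← cyclic-exists i r = not-¬ (defining N N∈Λ N⊇C r₀ (s r₀)) flipped
      where
      switched : switch r₀ (s r₀) ≡ true
      switched = cong (_∨ (used (s r₀) ∧ (s′ (s r₀) == r₀))) (cong₂ _∧_ c₀ (==-refl (s r₀)))
      flipped : N r₀ (s r₀) ≡ not (M r₀ (s r₀))
      flipped = trans (cong (M r₀ (s r₀) xor_) switched) (xor-comm (M r₀ (s r₀)) true)

  RowSink : (R K : Fin n → Bool) → Fin n → Set
  RowSink R K v = R v ≡ true × (∀ j → K j ≡ true → M v j ≡ true → C v j ≡ true)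

  ColSink : (R K : Fin n → Bool) → Fin n → Set
  ColSink R K w = K w ≡ true × (∀ i → R i ≡ true → M i w ≡ false → C i w ≡ true)

  NonEmpty : (R K : Fin n → Bool) → Set
  NonEmpty R K = (∃ λ i → R i ≡ true) ⊎ (∃ λ j → K j ≡ true)

  -- every nonempty (R, K) has a sink, since free cycles do not exist
  sink-exists : ∀ R K → NonEmpty R K → (∃ (RowSink R K)) ⊎ (∃ (ColSink R K))
  sink-exists R K nonempty with search (λ i → R i ∧ not (exists (free-one K i)))
  ... | found v e = inj₁ (v , proj₁ (∧-true e) , sink)
    where
    sink : ∀ j → K j ≡ true → M v j ≡ true → C v j ≡ true
    sink j k m₁ = ¬-not λ c → not-¬ (exists-complete (free-one K v) j (cong₂ _∧_ k (cong₂ _∧_ m₁ (cong not c))))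
                                     (not-true (proj₂ (∧-true {R v} e)))
  ... | none no-row-sink with search (λ j → K j ∧ not (exists (free-zero R j)))
  ...   | found w e = inj₂ (w , proj₁ (∧-true e) , sink)
    where
    sink : ∀ i → R i ≡ true → M i w ≡ false → C i w ≡ true
    sink i r m₀ = ¬-not λ c → not-¬ (exists-complete (free-zero R w) i (cong₂ _∧_ r (cong₂ _∧_ (cong not m₀) (cong not c))))
                                     (not-true (proj₂ (∧-true {K w} e)))
  ...   | none no-col-sink = ⊥-elim (empty nonempty)
    where
    row-out : ∀ i → R i ≡ true → ∃ λ j → free-one K i j ≡ true
    row-out i r = exists-sound (free-one K i) (not-false (trans (cong (λ b → b ∧ _) (sym r)) (no-row-sink i)))
    col-out : ∀ j → K j ≡ true → ∃ λ i → free-zero R j i ≡ true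
    col-out j k = exists-sound (free-zero R j) (not-false (trans (cong (λ b → b ∧ _) (sym k)) (no-col-sink j)))
    empty : NonEmpty R K → ⊥
    empty (inj₁ (i , r)) = FreeCycles.no-free-cycle R K i row-out col-out i r
    empty (inj₂ (j , k)) = FreeCycles.no-free-cycle R K j row-out col-out _ (proj₁ (s′-edge j k))
      where open FreeCycles R K j row-out col-out using (s′-edge)

  -- (R, K) is backward closed if no free edge enters it from outside
  BackwardClosed : (Fin n → Bool) → (Fin n → Bool) → Set
  BackwardClosed R K = ∀ i j → C i j ≡ false →
    (M i j ≡ true → K j ≡ true → R i ≡ true) × (M i j ≡ false → R i ≡ true → K j ≡ true)

  complement-forward : ∀ {R K} → BackwardClosed R K → ForwardClosed (λ i → not (R i)) (λ j → not (K j))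
  complement-forward {R} {K} closed i j free = via-one , via-zero
    where
    via-one : M i j ≡ true → not (R i) ≡ true → not (K j) ≡ true
    via-one m₁ nr = ¬-not λ nk → not-¬ (proj₁ (closed i j free) m₁ (not-false nk)) (not-true nr)
    via-zero : M i j ≡ false → not (K j) ≡ true → not (R i) ≡ true
    via-zero m₀ nk = ¬-not λ nr → not-¬ (proj₂ (closed i j free) m₀ (not-false nr)) (not-true nk)

  with-row : ∀ {RS KS} v → ForwardClosed RS KS → (∀ j → C v j ≡ false → M v j ≡ true → KS j ≡ true) →
    ForwardClosed (λ i → RS i ∨ (i == v)) KS
  with-row {RS} {KS} v closed v-out i j free = via-one , via-zero
    where
    via-one : M i j ≡ true → (RS i ∨ (i == v)) ≡ true → KS j ≡ true
    via-one m₁ rs with ∨-true rs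
    ... | inj₁ r  = proj₁ (closed i j free) m₁ r
    ... | inj₂ iv = let i≡v = ==-sound i v iv in
                    v-out j (subst (λ x → C x j ≡ false) i≡v free) (subst (λ x → M x j ≡ true) i≡v m₁)
    via-zero : M i j ≡ false → KS j ≡ true → (RS i ∨ (i == v)) ≡ true
    via-zero m₀ k = cong (_∨ (i == v)) (proj₂ (closed i j free) m₀ k)

  with-col : ∀ {RS KS} w → ForwardClosed RS KS → (∀ i → C i w ≡ false → M i w ≡ false → RS i ≡ true) →
    ForwardClosed RS (λ j → KS j ∨ (j == w))
  with-col {RS} {KS} w closed w-out i j free = via-one , via-zero
    where
    via-one : M i j ≡ true → RS i ≡ true → (KS j ∨ (j == w)) ≡ true
    via-one m₁ r = cong (_∨ (j == w)) (proj₁ (closed i j free) m₁ r)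
    via-zero : M i j ≡ false → (KS j ∨ (j == w)) ≡ true → RS i ≡ true
    via-zero m₀ ks with ∨-true ks
    ... | inj₁ k  = proj₂ (closed i j free) m₀ k
    ... | inj₂ jw = let j≡w = ==-sound j w jw in
                    w-out i (subst (λ x → C i x ≡ false) j≡w free) (subst (λ x → M i x ≡ false) j≡w m₀)

  just-row : ∀ v → (∀ j → C v j ≡ false → M v j ≡ false) → ForwardClosed (_== v) (λ _ → false)
  just-row v v-ones i j free = via-one , λ _ ()
    where
    via-one : M i j ≡ true → (i == v) ≡ true → false ≡ true
    via-one m₁ iv = let i≡v = ==-sound i v iv in
      ⊥-elim (not-¬ (subst (λ x → M x j ≡ true) i≡v m₁) (v-ones j (subst (λ x → C x j ≡ false) i≡v free)))

  all-but-row : ∀ v → (∀ j → C v j ≡ false → M v j ≡ true) → ForwardClosed (λ i → not (i == v)) (λ _ → true)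
  all-but-row v v-zeros i j free = (λ _ _ → refl) , via-zero
    where
    via-zero : M i j ≡ false → true ≡ true → not (i == v) ≡ true
    via-zero m₀ _ = ¬-not λ niv → let i≡v = ==-sound i v (not-false niv) in
      not-¬ (v-zeros j (subst (λ x → C x j ≡ false) i≡v free)) (subst (λ x → M x j ≡ false) i≡v m₀)

  just-col : ∀ w → (∀ i → C i w ≡ false → M i w ≡ true) → ForwardClosed (λ _ → false) (_== w)
  just-col w w-zeros i j free = (λ _ ()) , via-zero
    where
    via-zero : M i j ≡ false → (j == w) ≡ true → false ≡ true
    via-zero m₀ jw = let j≡w = ==-sound j w jw in
      ⊥-elim (not-¬ (w-zeros i (subst (λ x → C i x ≡ false) j≡w free)) (subst (λ x → M i x ≡ false) j≡w m₀))

  all-but-col : ∀ w → (∀ i → C i w ≡ false → M i w ≡ false) → ForwardClosed (λ _ → true) (λ j → not (j == w))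
  all-but-col w w-ones i j free = via-one , (λ _ _ → refl)
    where
    via-one : M i j ≡ true → true ≡ true → not (j == w) ≡ true
    via-one m₁ _ = ¬-not λ njw → let j≡w = ==-sound j w (not-false njw) in
      not-¬ (subst (λ x → M i x ≡ true) j≡w m₁) (w-ones i (subst (λ x → C i x ≡ false) j≡w free))

  -- A row sink v of a backward closed (R, K) is a sink line with the
  -- columns K as positions.  Each hypothesis of `SinkLine` is criticality
  -- (`critical-one`, `critical-zero`) applied to a suitable forward closed set.
  module RowSinkLine (R K : Fin n → Bool) (v : Fin n) (closed : BackwardClosed R K)
                     (r : R v ≡ true) (sink : ∀ j → K j ≡ true → M v j ≡ true → C v j ≡ true) where

    -- the complement of (R, K) together with row v is forward closed
    zeros-free : ∀ j → K j ≡ true → M v j ≡ false → C v j ≡ false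
    zeros-free j k m₀ = ¬-not λ c → not-¬ k (not-true (critical-zero c m₀ outside v-outside))
      where
      outside : ForwardClosed (λ i → not (R i) ∨ (i == v)) (λ j → not (K j))
      outside = with-row v (complement-forward closed) (λ j free m₁ → ¬-not λ nk → not-¬ (sink j (not-false nk) m₁) free)
      v-outside : (not (R v) ∨ (v == v)) ≡ true
      v-outside = trans (cong (not (R v) ∨_) (==-refl v)) (∨-zeroʳ (not (R v)))

    -- without free zeros in row v, all rows but v are forward closed
    free-zero-exists : (∃ λ j → M v j ≡ true × C v j ≡ true) → ∃ λ j → M v j ≡ false × C v j ≡ false
    free-zero-exists (j₀ , m₁ , c₁) with search (λ j → not (M v j) ∧ not (C v j))
    ... | found j e = j , not-true (proj₁ (∧-true e)) , not-true (proj₂ (∧-true {not (M v j)} e))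
    ... | none no-free = ⊥-elim (not-¬ (critical-one c₁ m₁ (all-but-row v no-free-zero) refl) (cong not (==-refl v)))
      where
      no-free-zero : ∀ j → C v j ≡ false → M v j ≡ true
      no-free-zero j free = ¬-not λ m₀ → not-¬ (cong₂ _∧_ (cong not m₀) (cong not free)) (no-free j)

    -- if all ones of row v are critical, row v alone is forward closed
    zeros-free-if-ones-critical : (∀ j → M v j ≡ true → C v j ≡ true) → ∀ j → M v j ≡ false → C v j ≡ false
    zeros-free-if-ones-critical all j m₀ = ¬-not λ c → not-¬ (critical-zero c m₀ (just-row v no-free-one) (==-refl v)) refl
      where
      no-free-one : ∀ j → C v j ≡ false → M v j ≡ false
      no-free-one j free = ¬-not λ m₁ → not-¬ (all j m₁) free

    free-zeros-inside : ∀ j → M v j ≡ false → C v j ≡ false → K j ≡ true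
    free-zeros-inside j m₀ free = proj₂ (closed v j free) m₀ r

    open SinkLine m (M v) (C v) K (row-count M∈Λ v) sink zeros-free free-zero-exists zeros-free-if-ones-critical free-zeros-inside
      public using (x; x≤m; x<K; x≡m)

  -- every column has m zeros, as n = 2m
  col-zeros : ∀ w → count (λ i → not (M i w)) ≡ m
  col-zeros w = +-cancelʳ-≡ m _ _ (begin
    count (λ i → not (M i w)) + m                       ≡⟨ cong (count (λ i → not (M i w)) +_) (sym (col-count M∈Λ w)) ⟩
    count (λ i → not (M i w)) + count (λ i → M i w)     ≡⟨ count-complement (λ i → M i w) ⟩
    m + (m + 0)                                         ≡⟨ cong (m +_) (+-identityʳ m) ⟩
    m + m                                               ∎)
    where open ≡-Reasoning

  -- Dually, a column sink w of a backward closed (R, K) is a sink line with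
  -- the rows R as positions, reading the zeros of column w as its "ones".
  module ColSinkLine (R K : Fin n → Bool) (w : Fin n) (closed : BackwardClosed R K)
                     (k : K w ≡ true) (sink : ∀ i → R i ≡ true → M i w ≡ false → C i w ≡ true) where

    zeros-critical : ∀ i → R i ≡ true → not (M i w) ≡ true → C i w ≡ true
    zeros-critical i r m₀ = sink i r (not-true m₀)

    -- the complement of (R, K) together with column w is forward closed
    ones-free : ∀ i → R i ≡ true → not (M i w) ≡ false → C i w ≡ false
    ones-free i r m₁ = ¬-not λ c → not-¬ r (not-true (critical-one c (not-false m₁) outside w-outside))
      where
      outside : ForwardClosed (λ i → not (R i)) (λ j → not (K j) ∨ (j == w))
      outside = with-col w (complement-forward closed) (λ i free m₀ → ¬-not λ nr → not-¬ (sink i (not-false nr) m₀) free)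
      w-outside : (not (K w) ∨ (w == w)) ≡ true
      w-outside = trans (cong (not (K w) ∨_) (==-refl w)) (∨-zeroʳ (not (K w)))

    -- without free ones in column w, all columns but w are forward closed
    free-one-exists : (∃ λ i → not (M i w) ≡ true × C i w ≡ true) → ∃ λ i → not (M i w) ≡ false × C i w ≡ false
    free-one-exists (i₀ , m₀ , c₀) with search (λ i → M i w ∧ not (C i w))
    ... | found i e = i , cong not (proj₁ (∧-true e)) , not-true (proj₂ (∧-true {M i w} e))
    ... | none no-free = ⊥-elim (not-¬ (critical-zero c₀ (not-true m₀) (all-but-col w no-free-one) refl) (cong not (==-refl w)))
      where
      no-free-one : ∀ i → C i w ≡ false → M i w ≡ false
      no-free-one i free = ¬-not λ m₁ → not-¬ (cong₂ _∧_ m₁ (cong not free)) (no-free i)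

    -- if all zeros of column w are critical, column w alone is forward closed
    ones-free-if-zeros-critical : (∀ i → not (M i w) ≡ true → C i w ≡ true) → ∀ i → not (M i w) ≡ false → C i w ≡ false
    ones-free-if-zeros-critical all i m₁ = ¬-not λ c → not-¬ (critical-one c (not-false m₁) (just-col w no-free-zero) (==-refl w)) refl
      where
      no-free-zero : ∀ i → C i w ≡ false → M i w ≡ true
      no-free-zero i free = ¬-not λ m₀ → not-¬ (all i (cong not m₀)) free

    free-ones-inside : ∀ i → not (M i w) ≡ false → C i w ≡ false → R i ≡ true
    free-ones-inside i m₁ free = proj₁ (closed i w free) (not-false m₁) k

    open SinkLine m (λ i → not (M i w)) (λ i → C i w) R (col-zeros w) zeros-critical ones-free free-one-exists
                    ones-free-if-zeros-critical free-ones-inside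
      public using (x; x≤m; x<K; x≡m)

  -- Removing a
  -- sink from a backward closed set leaves it backward closed and loses the
  -- sink's critical cells, which `RowSinkLine`/`ColSinkLine` bound.

  inside : (R K : Fin n → Bool) → ℕ
  inside R K = cells (λ i j → (R i ∧ K j) ∧ C i j)

  without : Fin n → (Fin n → Bool) → Fin n → Bool
  without v R i = R i ∧ not (i == v)

  count-without : ∀ R v → R v ≡ true → count R ≡ suc (count (without v R))
  count-without R v r = begin
    count R                                                     ≡⟨ count-split R (λ i → not (i == v)) ⟩
    count (without v R) + count (λ i → R i ∧ not (not (i == v))) ≡⟨ cong (count (without v R) +_) at-v ⟩
    count (without v R) + 1                                     ≡⟨ +-comm _ 1 ⟩
    suc (count (without v R))                                   ∎
    where
    open ≡-Reasoning
    at-v : count (λ i → R i ∧ not (not (i == v))) ≡ 1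
    at-v = trans (count-cong (λ i → cong (R i ∧_) (not-involutive (i == v)))) (trans (count-at R v) (cong ι r))

  remove-row : ∀ R K v → R v ≡ true → inside R K ≡ inside (without v R) K + count (λ j → K j ∧ C v j)
  remove-row R K v r = begin
    inside R K
      ≡⟨ cells-split P (λ i _ → not (i == v)) ⟩
    cells (λ i j → P i j ∧ not (i == v)) + cells (λ i j → P i j ∧ not (not (i == v)))
      ≡⟨ cong₂ _+_ (cells-cong rearrange) (cells-cong (λ i j → cong (P i j ∧_) (not-involutive (i == v)))) ⟩
    inside (without v R) K + cells (λ i j → P i j ∧ (i == v))
      ≡⟨ cong (inside (without v R) K +_) (trans (cells-row P v) (count-cong (λ j → cong (λ b → (b ∧ K j) ∧ C v j) r))) ⟩
    inside (without v R) K + count (λ j → K j ∧ C v j) ∎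
    where
    open ≡-Reasoning
    P = λ i j → (R i ∧ K j) ∧ C i j
    rearrange : ∀ i j → P i j ∧ not (i == v) ≡ (without v R i ∧ K j) ∧ C i j
    rearrange i j = trans (∧-middle (R i ∧ K j) (C i j) _) (cong (_∧ C i j) (∧-middle (R i) (K j) _))

  remove-col : ∀ R K w → K w ≡ true → inside R K ≡ inside R (without w K) + count (λ i → R i ∧ C i w)
  remove-col R K w k = begin
    inside R K
      ≡⟨ cells-split P (λ _ j → not (j == w)) ⟩
    cells (λ i j → P i j ∧ not (j == w)) + cells (λ i j → P i j ∧ not (not (j == w)))
      ≡⟨ cong₂ _+_ (cells-cong rearrange) (cells-cong (λ i j → cong (P i j ∧_) (not-involutive (j == w)))) ⟩
    inside R (without w K) + cells (λ i j → P i j ∧ (j == w))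
      ≡⟨ cong (inside R (without w K) +_) (trans (cells-col P w) (count-cong (λ i → cong (λ b → (R i ∧ b) ∧ C i w) k))) ⟩
    inside R (without w K) + count (λ i → (R i ∧ true) ∧ C i w)
      ≡⟨ cong (inside R (without w K) +_) (count-cong (λ i → cong (_∧ C i w) (∧-identityʳ (R i)))) ⟩
    inside R (without w K) + count (λ i → R i ∧ C i w) ∎
    where
    open ≡-Reasoning
    P = λ i j → (R i ∧ K j) ∧ C i j
    rearrange : ∀ i j → P i j ∧ not (j == w) ≡ (R i ∧ without w K j) ∧ C i j
    rearrange i j = trans (∧-middle (R i ∧ K j) (C i j) _) (cong (_∧ C i j) (∧-assoc (R i) (K j) _))

  backward-without-row : ∀ R K v → BackwardClosed R K → (∀ j → K j ≡ true → M v j ≡ true → C v j ≡ true) →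
    BackwardClosed (without v R) K
  backward-without-row R K v closed sink i j free = via-one , via-zero
    where
    via-one : M i j ≡ true → K j ≡ true → (R i ∧ not (i == v)) ≡ true
    via-one m₁ k = cong₂ _∧_ (proj₁ (closed i j free) m₁ k) (¬-not λ iv →
      let i≡v = ==-sound i v (not-false iv) in
      not-¬ (sink j k (subst (λ x → M x j ≡ true) i≡v m₁)) (subst (λ x → C x j ≡ false) i≡v free))
    via-zero : M i j ≡ false → (R i ∧ not (i == v)) ≡ true → K j ≡ true
    via-zero m₀ r = proj₂ (closed i j free) m₀ (proj₁ (∧-true r))

  backward-without-col : ∀ R K w → BackwardClosed R K → (∀ i → R i ≡ true → M i w ≡ false → C i w ≡ true) →
    BackwardClosed R (without w K)
  backward-without-col R K w closed sink i j free = via-one , via-zero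
    where
    via-one : M i j ≡ true → (K j ∧ not (j == w)) ≡ true → R i ≡ true
    via-one m₁ k = proj₁ (closed i j free) m₁ (proj₁ (∧-true k))
    via-zero : M i j ≡ false → R i ≡ true → (K j ∧ not (j == w)) ≡ true
    via-zero m₀ r = cong₂ _∧_ (proj₂ (closed i j free) m₀ r) (¬-not λ jw →
      let j≡w = ==-sound j w (not-false jw) in
      not-¬ (sink i r (subst (λ x → M i x ≡ false) j≡w m₀)) (subst (λ x → C i x ≡ false) j≡w free))

  sink-contribution : ∀ {x q} → x ≤ m → (1 ≤ x → x < q) → (x ≡ m → q ≡ n) → q < n → x < m × (x ≡ 0 ⊎ x < q)
  sink-contribution {x} x≤m x<q full q<n = ≤∧≢⇒< x≤m (λ x≡m → <-irrefl (full x≡m) q<n) , zero-or-below x x<q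
    where
    zero-or-below : ∀ x → (1 ≤ x → x < _) → x ≡ 0 ⊎ x < _
    zero-or-below zero    _   = inj₁ refl
    zero-or-below (suc x) x<q = inj₂ (x<q (s≤s z≤n))

  peeling : ∀ k R K → count R + count K ≡ k → BackwardClosed R K → count R < n → count K < n →
    inside R K ≤ bound m (count R) (count K)
  peeling k R K size closed R<n K<n with search R
  ... | none no-rows =
    ≤-trans (≤-reflexive (cells-none _ (λ i j → cong (λ b → (b ∧ K j) ∧ C i j) (no-rows i)))) z≤n
  ... | found i r with k | sink-exists R K (inj₁ (i , r))
  ...   | zero | _ = ⊥-elim (<-irrefl refl (≤-trans (≤-trans (count-pos R i r) (m≤m+n (count R) (count K))) (≤-reflexive size)))
  ...   | suc k′ | inj₁ (v , rv , sink) = begin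
    inside R K                          ≡⟨ remove-row R K v rv ⟩
    inside R′ K + x                     ≤⟨ +-monoˡ-≤ x (peeling k′ R′ K size′ closed′ R′<n K<n) ⟩
    bound m (count R′) (count K) + x    ≤⟨ bound-step m _ _ x (proj₁ contribution) (proj₂ contribution) ⟩
    bound m (suc (count R′)) (count K)  ≡⟨ cong (λ a → bound m a (count K)) (sym (count-without R v rv)) ⟩
    bound m (count R) (count K)         ∎
    where
    open ≤-Reasoning
    open RowSinkLine R K v closed rv sink using (x; x≤m; x<K; x≡m)
    R′ = without v R
    size′ : count R′ + count K ≡ k′
    size′ = suc-injective (trans (cong (_+ count K) (sym (count-without R v rv))) size)
    closed′ = backward-without-row R K v closed sink
    R′<n : count R′ < n
    R′<n = <⇒≤ (subst (_< n) (count-without R v rv) R<n)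
    contribution = sink-contribution x≤m x<K x≡m K<n
  ...   | suc k′ | inj₂ (w , kw , sink) = begin
    inside R K                          ≡⟨ remove-col R K w kw ⟩
    inside R K′ + x                     ≤⟨ +-monoˡ-≤ x (peeling k′ R K′ size′ closed′ R<n K′<n) ⟩
    bound m (count R) (count K′) + x    ≡⟨ cong (_+ x) (bound-sym m (count R) (count K′)) ⟩
    bound m (count K′) (count R) + x    ≤⟨ bound-step m _ _ x (proj₁ contribution) (proj₂ contribution) ⟩
    bound m (suc (count K′)) (count R)  ≡⟨ bound-sym m (suc (count K′)) (count R) ⟩
    bound m (count R) (suc (count K′))  ≡⟨ cong (bound m (count R)) (sym (count-without K w kw)) ⟩
    bound m (count R) (count K)         ∎
    where
    open ≤-Reasoning
    open ColSinkLine R K w closed kw sink using (x; x≤m; x<K; x≡m)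
    K′ = without w K
    size′ : count R + count K′ ≡ k′
    size′ = suc-injective (trans (sym (+-suc (count R) (count K′))) (trans (cong (count R +_) (sym (count-without K w kw))) size))
    closed′ = backward-without-col R K w closed sink
    K′<n : count K′ < n
    K′<n = <⇒≤ (subst (_< n) (count-without K w kw) K<n)
    contribution = sink-contribution x≤m x<K x≡m R<n

  -- With every column present the columns cannot be
  -- bounded by `peeling`; instead rows are peeled one at a time, each row
  -- sink contributing at most m, until the first column sink appears.  After
  -- removing it, `peeling` applies to the u rows left and the other 2m - 1
  -- columns.  TailBound k c records the outcome for a strip of k rows carrying
  -- c critical cells; the same shape arises with rows and columns exchanged.
  everything : Fin n → Bool
  everything _ = true

  TailBound : ℕ → ℕ → Set
  TailBound k c = ∃ λ u → ∃ λ y → u ≤ k × y < m × (y ≡ 0 ⊎ y < u) × c ≤ (k ∸ u) * m + bound m u (n ∸ 1) + y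

  add-line : ∀ {c A B y x} → c ≤ A + B + y → x ≤ m → c + x ≤ m + A + B + y
  add-line {c} {A} {B} {y} {x} c≤ x≤m =
    ≤-trans (+-mono-≤ c≤ x≤m) (≤-reflexive (shuffle A B y m))
    where
    shuffle : ∀ A B y m → A + B + y + m ≡ m + A + B + y
    shuffle = solve-∀

  tail-step : ∀ {k c x} → TailBound k c → x ≤ m → TailBound (suc k) (c + x)
  tail-step {k} {c} {x} (u , y , u≤k , y<m , y-small , c≤) x≤m =
    u , y , m≤n⇒m≤1+n u≤k , y<m , y-small ,
    subst (λ d → c + x ≤ d * m + bound m u (n ∸ 1) + y) (sym (+-∸-assoc 1 u≤k)) (add-line c≤ x≤m)

  count-all-but : ∀ v → count (without v everything) ≡ n ∸ 1
  count-all-but v = trans (cong (_∸ 1) (sym (count-without everything v refl))) (cong (_∸ 1) (count-all everything (λ _ → refl)))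

  strip-rows : ∀ k R → count R ≡ k → BackwardClosed R everything → k < n → Fin n → TailBound k (inside R everything)
  strip-rows k R size closed k<n z with sink-exists R everything (inj₂ (z , refl))
  ... | inj₂ (w , _ , sink) = k , x , ≤-refl , proj₁ contribution , subst (λ q → x ≡ 0 ⊎ x < q) size (proj₂ contribution) , bounded
    where
    open ColSinkLine R everything w closed refl sink using (x; x≤m; x<K; x≡m)
    R<n = subst (_< n) (sym size) k<n
    contribution = sink-contribution x≤m x<K x≡m R<n
    K′ = without w everything
    K′<n : count K′ < n
    K′<n = subst (_< n) (sym (count-all-but w)) (Fin⇒∸1< z)
    bounded : inside R everything ≤ (k ∸ k) * m + bound m k (n ∸ 1) + x
    bounded = begin
      inside R everything             ≡⟨ remove-col R everything w refl ⟩
      inside R K′ + x                  ≤⟨ +-monoˡ-≤ x (peeling _ R K′ refl (backward-without-col R everything w closed sink) R<n K′<n) ⟩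
      bound m (count R) (count K′) + x ≡⟨ cong₂ (λ a b → bound m a b + x) size (count-all-but w) ⟩
      bound m k (n ∸ 1) + x            ≡⟨ cong (λ d → d * m + bound m k (n ∸ 1) + x) (sym (n∸n≡0 k)) ⟩
      (k ∸ k) * m + bound m k (n ∸ 1) + x ∎
      where open ≤-Reasoning
  ... | inj₁ (v , rv , sink) with k
  ...   | zero   = ⊥-elim (<-irrefl refl (≤-trans (count-pos R v rv) (≤-reflexive size)))
  ...   | suc k′ = subst (TailBound (suc k′)) (sym (remove-row R everything v rv))
                     (tail-step (strip-rows k′ (without v R) size′ closed′ (<⇒≤ k<n) z) x≤m)
    where
    open RowSinkLine R everything v closed rv sink using (x; x≤m)
    size′ : count (without v R) ≡ k′
    size′ = suc-injective (trans (sym (count-without R v rv)) size)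
    closed′ = backward-without-row R everything v closed sink

  strip-cols : ∀ k K → count K ≡ k → BackwardClosed everything K → k < n → Fin n → TailBound k (inside everything K)
  strip-cols k K size closed k<n z with sink-exists everything K (inj₁ (z , refl))
  ... | inj₁ (v , _ , sink) = k , x , ≤-refl , proj₁ contribution , subst (λ q → x ≡ 0 ⊎ x < q) size (proj₂ contribution) , bounded
    where
    open RowSinkLine everything K v closed refl sink using (x; x≤m; x<K; x≡m)
    K<n = subst (_< n) (sym size) k<n
    contribution = sink-contribution x≤m x<K x≡m K<n
    R′ = without v everything
    R′<n : count R′ < n
    R′<n = subst (_< n) (sym (count-all-but v)) (Fin⇒∸1< z)
    bounded : inside everything K ≤ (k ∸ k) * m + bound m k (n ∸ 1) + x
    bounded = begin
      inside everything K              ≡⟨ remove-row everything K v refl ⟩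
      inside R′ K + x                  ≤⟨ +-monoˡ-≤ x (peeling _ R′ K refl (backward-without-row everything K v closed sink) R′<n K<n) ⟩
      bound m (count R′) (count K) + x ≡⟨ cong₂ (λ a b → bound m a b + x) (count-all-but v) size ⟩
      bound m (n ∸ 1) k + x            ≡⟨ cong (_+ x) (bound-sym m (n ∸ 1) k) ⟩
      bound m k (n ∸ 1) + x            ≡⟨ cong (λ d → d * m + bound m k (n ∸ 1) + x) (sym (n∸n≡0 k)) ⟩
      (k ∸ k) * m + bound m k (n ∸ 1) + x ∎
      where open ≤-Reasoning
  ... | inj₂ (w , kw , sink) with k
  ...   | zero   = ⊥-elim (<-irrefl refl (≤-trans (count-pos K w kw) (≤-reflexive size)))
  ...   | suc k′ = subst (TailBound (suc k′)) (sym (remove-col everything K w kw))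
                     (tail-step (strip-cols k′ (without w K) size′ closed′ (<⇒≤ k<n) z) x≤m)
    where
    open ColSinkLine everything K w closed kw sink using (x; x≤m)
    size′ : count (without w K) ≡ k′
    size′ = suc-injective (trans (sym (count-without K w kw)) size)
    closed′ = backward-without-col everything K w closed sink

  everything-closed : BackwardClosed everything everything
  everything-closed _ _ _ = (λ _ _ → refl) , (λ _ _ → refl)

  strip-estimate : 2 ≤ m → ∀ {c x} → TailBound (n ∸ 1) c → x ≤ m → c + x ≤ 3 * m * m ∸ 2 * m
  strip-estimate 2≤m (u , y , u≤ , y<m , y-small , c≤) x≤m =
    ≤-trans (add-line c≤ x≤m) (final-estimate m u y 2≤m u≤ y<m y-small)

  -- The whole array: remove a first sink (at most m cells) from everything,
  -- then peel the remaining strip.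
  whole : 2 ≤ m → Fin n → inside everything everything ≤ 3 * m * m ∸ 2 * m
  whole 2≤m z with sink-exists everything everything (inj₁ (z , refl))
  ... | inj₁ (v , _ , sink) =
    subst (_≤ 3 * m * m ∸ 2 * m) (sym (remove-row everything everything v refl))
      (strip-estimate 2≤m (strip-rows (n ∸ 1) (without v everything) (count-all-but v) closed (Fin⇒∸1< z) z) x≤m)
    where
    open RowSinkLine everything everything v everything-closed refl sink using (x; x≤m)
    closed = backward-without-row everything everything v everything-closed sink
  ... | inj₂ (w , _ , sink) =
    subst (_≤ 3 * m * m ∸ 2 * m) (sym (remove-col everything everything w refl))
      (strip-estimate 2≤m (strip-cols (n ∸ 1) (without w everything) (count-all-but w) closed (Fin⇒∸1< z) z) x≤m)
    where
    open ColSinkLine everything everything w everything-closed refl sink using (x; x≤m)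
    closed = backward-without-col everything everything w everything-closed sink

-- The case m = 1.  A 2×2 matrix with all line sums 1 is determined by any
-- single entry, so every single cell is a defining set, and by minimality a
-- critical set has at most one cell.
module TwoByTwo (M : Matrix 2) (M∈Λ : InΛ 2 1 M) (C : PosSet 2) (critical : IsCritical 1 M C) where

  -- the entry at (i, j) given the entry b at (0, 0)
  entry : Fin 2 → Fin 2 → Bool → Bool
  entry i j b = if i == j then b else not b

  entry-injective : ∀ i j {a b} → entry i j a ≡ entry i j b → a ≡ b
  entry-injective i j e with i == j
  ... | true  = e
  ... | false = Bool.not-injective e

  complementary : ∀ a b → ι a + (ι b + 0) ≡ 1 → b ≡ not a
  complementary true  false _ = refl
  complementary false true  _ = refl

  entries : ∀ (P : Matrix 2) → InΛ 2 1 P → ∀ i j → P i j ≡ entry i j (P zero zero)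
  entries P _ zero zero = refl
  entries P P∈Λ zero (suc zero) =
    complementary (P zero zero) (P zero (suc zero)) (trans (sym (countTrue≡count (P zero))) (proj₁ P∈Λ zero))
  entries P P∈Λ (suc zero) zero =
    complementary (P zero zero) (P (suc zero) zero) (trans (sym (countTrue≡count (λ i → P i zero))) (proj₂ P∈Λ zero))
  entries P P∈Λ (suc zero) (suc zero) = begin
    P (suc zero) (suc zero)   ≡⟨ complementary _ _ (trans (sym (countTrue≡count (P (suc zero)))) (proj₁ P∈Λ (suc zero))) ⟩
    not (P (suc zero) zero)   ≡⟨ cong not (entries P P∈Λ (suc zero) zero) ⟩
    not (not (P zero zero))   ≡⟨ not-involutive _ ⟩
    P zero zero               ∎
    where open ≡-Reasoning

  single : Fin 2 → Fin 2 → PosSet 2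
  single i₀ j₀ i j = (i == i₀) ∧ (j == j₀)

  single-defining : ∀ i₀ j₀ → IsDefining 1 M (single i₀ j₀)
  single-defining i₀ j₀ N N∈Λ N⊇single i j = begin
    N i j                     ≡⟨ entries N N∈Λ i j ⟩
    entry i j (N zero zero)   ≡⟨ cong (entry i j) same-corner ⟩
    entry i j (M zero zero)   ≡⟨ sym (entries M M∈Λ i j) ⟩
    M i j                     ∎
    where
    open ≡-Reasoning
    at-cell : N i₀ j₀ ≡ M i₀ j₀
    at-cell = N⊇single i₀ j₀ (Equivalence.from T-≡ (cong₂ _∧_ (==-refl i₀) (==-refl j₀)))
    same-corner : N zero zero ≡ M zero zero
    same-corner = entry-injective i₀ j₀ (trans (sym (entries N N∈Λ i₀ j₀)) (trans at-cell (entries M M∈Λ i₀ j₀)))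

  single-card : ∀ i₀ j₀ → cells (single i₀ j₀) ≡ 1
  single-card i₀ j₀ = trans (cells-cong (λ i j → ∧-comm (i == i₀) (j == j₀)))
                            (trans (cells-row (λ _ j → j == j₀) i₀) (count-point j₀))

  -- C contains some cell, whose singleton is defining, so C is that singleton
  at-most-one : card C ≤ 1
  at-most-one with card C ≤? 1
  ... | yes ≤1 = ≤1
  ... | no  ≰1 = ⊥-elim (proj₂ critical (single i₀ j₀) (single⊆C , C⊈single) (single-defining i₀ j₀))
    where
    nonempty : 0 < cells C
    nonempty = subst (0 <_) (card≡cells C) (≤-trans (s≤s z≤n) (≰⇒> ≰1))
    i₀ = proj₁ (cells-witness C nonempty)
    j₀ = proj₁ (proj₂ (cells-witness C nonempty))
    c₀ : C i₀ j₀ ≡ true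
    c₀ = proj₂ (proj₂ (cells-witness C nonempty))
    single⊆C : single i₀ j₀ ⊆ₚ C
    single⊆C i j t = let (i≡ , j≡) = ∧-true (Equivalence.to T-≡ t) in
      Equivalence.from T-≡ (subst₂ (λ a b → C a b ≡ true) (sym (==-sound i i₀ i≡)) (sym (==-sound j j₀ j≡)) c₀)
    C⊈single : ¬ (C ⊆ₚ single i₀ j₀)
    C⊈single C⊆single = ≰1 (begin
      card C                    ≡⟨ card≡cells C ⟩
      cells C                   ≤⟨ cells-mono (λ i j e → Equivalence.to T-≡ (C⊆single i j (Equivalence.from T-≡ e))) ⟩
      cells (single i₀ j₀)      ≡⟨ single-card i₀ j₀ ⟩
      1                         ∎)
      where open ≤-Reasoning

corollary12 : (m : ℕ) → 1 ≤ m → (M : Matrix (2 * m)) → InΛ (2 * m) m M →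
    (C : PosSet (2 * m)) → IsCritical m M C → card C ≤ 3 * m * m ∸ 2 * m
corollary12 (suc zero) _ M M∈Λ C critical = TwoByTwo.at-most-one M M∈Λ C critical
corollary12 m@(suc (suc _)) _ M M∈Λ C critical =
  subst (_≤ 3 * m * m ∸ 2 * m) (sym (card≡cells C)) (Critical.whole m M M∈Λ C critical (s≤s (s≤s z≤n)) zero)
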